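{- Let $s,t\ge 1$ be integers such that $s$ divides $2t(t+1)$, and let $r=\frac{2t(t+1)}{s}$. Then for all $k$, \[ P(GS_{r+3t+1,s,t},k)=P(GS_{t,r+s+2t+1,t},k)=P(GS_{3t+s+1,r,t},k). \]
   Context: Forest building process: given a finite graph $G$ and a linear ordering of its edges, go through the edges in order and keep an edge if and only if at least one of its endpoints is not an endpoint of any earlier edge in the ordering (earlier edges count whether or not they were kept). The kept edges form a forest. $P(G,k)$ denotes the probability that, for a uniformly random ordering of the edges of $G$, the resulting forest has exactly $k$ trees. The glued-star graph $GS_{a,b,c}$ has two center vertices $u,w$, $a$ vertices adjacent only to $u$, $b$ vertices adjacent to both $u$ and $w$, and $c$ vertices adjacent only to $w$ (i.e., the stars $K_{1,a+b}$ and $K_{1,b+c}$ with $b$ of their leaves identified). -}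

module Defs where

open import Data.Bool using (Bool; true; false; _∧_; _∨_; not; if_then_else_)
open import Data.Nat using (ℕ; zero; suc; _+_; _*_; _≡ᵇ_; _≤ᵇ_; _!)
open import Data.Nat.Properties using (_!≢0)
open import Data.List using (List; []; _∷_; map; length; filter; concatMap; upTo; _++_)
open import Data.Bool.ListAction using (any; all)
open import Data.Product using (_×_; _,_)
open import Data.Integer using (+_)
open import Data.Rational using (ℚ; _/_)
open import Relation.Nullary.Decidable using (T?)

-- A finite graph: a list of (distinct) vertices and a list of (distinct) edges,
-- each edge being an unordered pair written as an ordered pair of vertices.
record Graph : Set where
  constructor mkGraph
  field
    verts : List ℕ
    edges : List (ℕ × ℕ)
open Graph public

Edge : Set
Edge = ℕ × ℕ

_∈ᵇ_ : ℕ → List ℕ → Bool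
x ∈ᵇ xs = any (λ y → y ≡ᵇ x) xs

insertions : {A : Set} → A → List A → List (List A)
insertions x [] = (x ∷ []) ∷ []
insertions x (y ∷ ys) = (x ∷ y ∷ ys) ∷ map (y ∷_) (insertions x ys)

perms : {A : Set} → List A → List (List A)
perms [] = [] ∷ []
perms (x ∷ xs) = concatMap (insertions x) (perms xs)

-- The forest building process.  'seen' is the set of endpoints of all
-- earlier edges (kept or not).  An edge is kept iff at least one of its
-- endpoints has not been seen yet.
buildFrom : List ℕ → List Edge → List Edge
buildFrom seen [] = []
buildFrom seen ((x , y) ∷ es) =
  if not (x ∈ᵇ seen) ∨ not (y ∈ᵇ seen)
  then (x , y) ∷ buildFrom (x ∷ y ∷ seen) es
  else buildFrom (x ∷ y ∷ seen) es

buildForest : List Edge → List Edge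
buildForest = buildFrom []

adj : List Edge → ℕ → ℕ → Bool
adj F x y = any (λ e → let (a , b) = e in
                   ((a ≡ᵇ x) ∧ (b ≡ᵇ y)) ∨ ((a ≡ᵇ y) ∧ (b ≡ᵇ x))) F

reachWithin : List ℕ → List Edge → ℕ → ℕ → ℕ → Bool
reachWithin V F zero x y = x ≡ᵇ y
reachWithin V F (suc i) x y =
  reachWithin V F i x y ∨ any (λ z → reachWithin V F i x z ∧ adj F z y) V

-- x and y lie in the same connected component (walks of length ≤ |V|
-- suffice, since a shortest walk is a path)
connected : List ℕ → List Edge → ℕ → ℕ → Bool
connected V F x y = reachWithin V F (length V) x y

-- number of connected components: count the vertices that are the least
-- vertex of their component
numComponents : List ℕ → List Edge → ℕ
numComponents V F =
  length (filter (λ v → T? (all (λ x → not (connected V F v x) ∨ (v ≤ᵇ x)) V)) V)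

numTrees : Graph → List Edge → ℕ
numTrees G ord = numComponents (verts G) (buildForest ord)

countOrderings : Graph → ℕ → ℕ
countOrderings G k =
  length (filter (λ ord → T? (numTrees G ord ≡ᵇ k)) (perms (edges G)))

P : Graph → ℕ → ℚ
P G k = (+ countOrderings G k) / (length (edges G) !)
  where instance _ = length (edges G) !≢0

-- The glued-star graph GS_{a,b,c}:
--   u = 0, w = 1,
--   a-leaves 2 .. a+1 (adjacent to u only),
--   b-leaves a+2 .. a+b+1 (adjacent to both u and w),
--   c-leaves a+b+2 .. a+b+c+1 (adjacent to w only).
GS : ℕ → ℕ → ℕ → Graph
GS a b c = mkGraph (upTo (2 + a + b + c)) (edgesA ++ edgesB ++ edgesC)
  where
  edgesA = map (λ i → (0 , 2 + i)) (upTo a)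
  edgesB = concatMap (λ j → (0 , 2 + a + j) ∷ (1 , 2 + a + j) ∷ []) (upTo b)
  edgesC = map (λ l → (1 , 2 + a + b + l)) (upTo c)

module Submission where

-- Every edge of a glued star GS_{a,b,c} joins a centre (0 or 1) to a
-- leaf, and every leaf keeps its first edge, so the forest has one tree if
-- some shared leaf keeps both of its edges and two trees otherwise.  This event
-- is decided by a simple recursive test  joins  on the ordering (correctness:
-- joins⇔Joined, Components).  Counting the orderings accepted by  joins  by
-- recursion on the first edge (Counting, Start) shows that a single tree occurs
-- with probability  b/((a+b)(a+b+1)) + b/((b+c)(b+c+1)).  Hence two glued
-- stars have the same distribution as soon as these fractions agree
-- (P-GS-equal), and for the three graphs of the proposition this is the
-- polynomial identity  fractions-agree, which follows from  x·y = 2t(t+1)  via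
-- the factorisations  x·N = (x+2t)(x+t+1)  and  x·(x+2y+4t+2) = (x+2t)(x+2t+2).

open import Defs
open import Data.Bool using (Bool; true; false; T; _∧_; _∨_; not; if_then_else_)
open import Data.Bool.Properties using (∨-zeroʳ; ∨-identityʳ; ∧-identityʳ; ∧-zeroʳ)
open import Data.Bool.ListAction using (any; all)
open import Relation.Nullary.Decidable using (T?)
open import Data.Nat using (ℕ; zero; suc; _+_; _*_; _∸_; _!; _≡ᵇ_; _≤ᵇ_; _≤_; s≤s; z≤n; pred; NonZero; >-nonZero; _≟_)
open import Data.Nat.Properties
  using (+-assoc; +-suc; +-identityʳ; *-identityʳ; *-identityˡ; *-assoc; *-comm; *-distribʳ-+; suc-injective;
         _!≢0; *-cancelʳ-≡; *-cancelˡ-≡; +-cancelˡ-≡; ≡ᵇ⇒≡; <⇒≢; m≤n+m)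
open import Data.Nat.Divisibility using (_∣_)
open import Data.Nat.Tactic.RingSolver using (solve-∀)
open import Data.List using (List; []; _∷_; [_]; _++_; map; length; concatMap; filter; applyUpTo; upTo)
open import Data.List.Properties using (length-map; length-++; ++-assoc; ++-identityʳ; map-upTo; map-applyUpTo; length-applyUpTo)
open import Data.List.Relation.Unary.All as All using (All; []; _∷_)
open import Data.List.Relation.Unary.Any using (here; there)
open import Data.List.Membership.Propositional using (_∈_; _∉_; find)
open import Data.List.Membership.Propositional.Properties using (∈-++⁺ˡ; ∈-++⁺ʳ; ∈-++⁻; ∈-map⁺; ∈-map⁻; ∈-concatMap⁻)
open import Data.List.Relation.Binary.Permutation.Propositional as ↭ using (_↭_; prep; swap; ↭-sym; ↭-reflexive)
open import Data.List.Relation.Binary.Permutation.Propositional.Properties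
  using (↭-length; ∈-resp-↭; All-resp-↭; map⁺; ++⁺ˡ; ++⁺ʳ; ++⁺; shift; ++-commutativeMonoid)
import Data.List.Relation.Binary.Permutation.Setoid.Properties as SetoidPermutation
open import Data.List.Relation.Unary.Unique.Propositional using (Unique)
open import Data.List.Relation.Unary.Unique.Propositional.Properties using (Unique[x∷xs]⇒x∉xs; applyUpTo⁺₁)
import Data.List.Relation.Unary.AllPairs as AllPairs
import Algebra.Solver.CommutativeMonoid as CommutativeMonoidSolver
import Data.Integer as ℤ
open import Data.Integer.Properties using (pos-*)
open import Data.Rational using (_/_)
open import Data.Rational.Properties using (fromℚᵘ-cong)
open import Data.Rational.Unnormalised.Base using (*≡*; mkℚᵘ)
open import Data.Product using (Σ; _×_; _,_; proj₁; proj₂)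
open import Data.Sum using (_⊎_; inj₁; inj₂)
open import Data.Empty using (⊥; ⊥-elim)
open import Relation.Nullary using (¬_; yes; no)
open import Function.Bundles using (_⇔_; mk⇔; Equivalence)
open import Relation.Binary.PropositionalEquality hiding ([_])

sumBy : {B : Set} → (B → ℕ) → List B → ℕ
sumBy f [] = 0
sumBy f (x ∷ xs) = f x + sumBy f xs

sumBy-++ : {B : Set} (f : B → ℕ) (xs ys : List B) → sumBy f (xs ++ ys) ≡ sumBy f xs + sumBy f ys
sumBy-++ f [] ys = refl
sumBy-++ f (x ∷ xs) ys rewrite sumBy-++ f xs ys = sym (+-assoc (f x) (sumBy f xs) (sumBy f ys))

sumBy-map : {B C : Set} (w : C → ℕ) (g : B → C) (xs : List B) →
  sumBy w (map g xs) ≡ sumBy (λ x → w (g x)) xs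
sumBy-map w g [] = refl
sumBy-map w g (x ∷ xs) = cong (w (g x) +_) (sumBy-map w g xs)

sumBy-concatMap : {B C : Set} (w : C → ℕ) (g : B → List C) (xs : List B) →
  sumBy w (concatMap g xs) ≡ sumBy (λ x → sumBy w (g x)) xs
sumBy-concatMap w g [] = refl
sumBy-concatMap w g (x ∷ xs) =
  trans (sumBy-++ w (g x) (concatMap g xs)) (cong (sumBy w (g x) +_) (sumBy-concatMap w g xs))

sumBy-cong : {B : Set} {f g : B → ℕ} → (∀ x → f x ≡ g x) → (xs : List B) → sumBy f xs ≡ sumBy g xs
sumBy-cong e [] = refl
sumBy-cong e (x ∷ xs) = cong₂ _+_ (e x) (sumBy-cong e xs)

sumBy-congᴬ : {B : Set} {f g : B → ℕ} {xs : List B} → All (λ x → f x ≡ g x) xs → sumBy f xs ≡ sumBy g xs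
sumBy-congᴬ [] = refl
sumBy-congᴬ (e ∷ es) = cong₂ _+_ e (sumBy-congᴬ es)

sumBy-+ : {B : Set} (f g : B → ℕ) (xs : List B) → sumBy (λ x → f x + g x) xs ≡ sumBy f xs + sumBy g xs
sumBy-+ f g [] = refl
sumBy-+ f g (x ∷ xs) rewrite sumBy-+ f g xs = interchange (f x) (g x) (sumBy f xs) (sumBy g xs)
  where
  interchange : ∀ a b c d → (a + b) + (c + d) ≡ (a + c) + (b + d)
  interchange = solve-∀

sumBy-vanishes : {B : Set} {f : B → ℕ} {xs : List B} → All (λ x → f x ≡ 0) xs → sumBy f xs ≡ 0
sumBy-vanishes [] = refl
sumBy-vanishes (e ∷ es) rewrite e = sumBy-vanishes es

sumBy-uniform : {B : Set} {f : B → ℕ} {D K : ℕ} {xs : List B} → All (λ x → f x * D ≡ K) xs →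
  sumBy f xs * D ≡ length xs * K
sumBy-uniform [] = refl
sumBy-uniform {f = f} {D} {K} {x ∷ xs} (e ∷ es) =
  trans (*-distribʳ-+ D (f x) (sumBy f xs)) (cong₂ _+_ e (sumBy-uniform es))

module PermutationSolver {A : Set} = CommutativeMonoidSolver (++-commutativeMonoid {A = A})

Unique-↭ : {A : Set} {xs ys : List A} → xs ↭ ys → Unique xs → Unique ys
Unique-↭ {A} p = SetoidPermutation.Unique-resp-↭ (setoid A) (↭.↭⇒↭ₛ p)

module _ {A : Set} where

  Σperm : (List A → ℕ) → List A → ℕ
  Σperm w L = sumBy w (perms L)

  Σins : A → (List A → ℕ) → List A → ℕ
  Σins x w σ = sumBy w (insertions x σ)

  Σperm-∷ : (w : List A → ℕ) (x : A) (xs : List A) → Σperm w (x ∷ xs) ≡ Σperm (Σins x w) xs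
  Σperm-∷ w x xs = sumBy-concatMap w (insertions x) (perms xs)

  Σins-∷ : (x y : A) (w : List A → ℕ) (σ : List A) →
    Σins x w (y ∷ σ) ≡ w (x ∷ y ∷ σ) + Σins x (λ τ → w (y ∷ τ)) σ
  Σins-∷ x y w σ = cong (w (x ∷ y ∷ σ) +_) (sumBy-map w (y ∷_) (insertions x σ))

  Σperm-cong : {f g : List A → ℕ} → (∀ σ → f σ ≡ g σ) → (L : List A) → Σperm f L ≡ Σperm g L
  Σperm-cong e L = sumBy-cong e (perms L)

  Σins-cong : {f g : List A → ℕ} → (∀ σ → f σ ≡ g σ) → (x : A) (σ : List A) → Σins x f σ ≡ Σins x g σ
  Σins-cong e x σ = sumBy-cong e (insertions x σ)

  Σperm-+ : (f g : List A → ℕ) (L : List A) → Σperm (λ σ → f σ + g σ) L ≡ Σperm f L + Σperm g L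
  Σperm-+ f g L = sumBy-+ f g (perms L)

  Σins-+ : (f g : List A → ℕ) (x : A) (σ : List A) →
    Σins x (λ τ → f τ + g τ) σ ≡ Σins x f σ + Σins x g σ
  Σins-+ f g x σ = sumBy-+ f g (insertions x σ)

  Σperm-zero : (L : List A) → Σperm (λ _ → 0) L ≡ 0
  Σperm-zero L = zeros (perms L)
    where
    zeros : (l : List (List A)) → sumBy (λ _ → 0) l ≡ 0
    zeros [] = refl
    zeros (_ ∷ l) = zeros l

  Σins-comm : ∀ (x y : A) σ (w : List A → ℕ) → Σins y (Σins x w) σ ≡ Σins x (Σins y w) σ
  Σins-comm x y [] w = swap₂ (w (x ∷ y ∷ [])) (w (y ∷ x ∷ []))
    where
    swap₂ : ∀ a b → (a + (b + 0)) + 0 ≡ (b + (a + 0)) + 0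
    swap₂ = solve-∀
  Σins-comm x y (z ∷ σ) w = begin
      Σins y (Σins x w) (z ∷ σ)
    ≡⟨ Σins-∷ y z (Σins x w) σ ⟩
      Σins x w (y ∷ z ∷ σ) + Σins y (λ τ → Σins x w (z ∷ τ)) σ
    ≡⟨ cong₂ _+_ (expand-front x y) (expand-back x y) ⟩
      (xy + (yx + xs)) + (ys + yxRest)
    ≡⟨ cong (λ q → (xy + (yx + xs)) + (ys + q)) (Σins-comm x y σ (λ τ → w (z ∷ τ))) ⟩
      (xy + (yx + xs)) + (ys + xyRest)
    ≡⟨ regroup xy yx xs ys xyRest ⟩
      (yx + (xy + ys)) + (xs + xyRest)
    ≡⟨ sym (cong₂ _+_ (expand-front y x) (expand-back y x)) ⟩
      Σins y w (x ∷ z ∷ σ) + Σins x (λ τ → Σins y w (z ∷ τ)) σ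
    ≡⟨ sym (Σins-∷ x z (Σins y w) σ) ⟩
      Σins x (Σins y w) (z ∷ σ)
    ∎
    where
    open ≡-Reasoning
    xy = w (x ∷ y ∷ z ∷ σ)
    yx = w (y ∷ x ∷ z ∷ σ)
    xs = Σins x (λ τ → w (y ∷ z ∷ τ)) σ
    ys = Σins y (λ τ → w (x ∷ z ∷ τ)) σ
    yxRest = Σins y (Σins x (λ τ → w (z ∷ τ))) σ
    xyRest = Σins x (Σins y (λ τ → w (z ∷ τ))) σ
    expand-front : ∀ p q → Σins p w (q ∷ z ∷ σ) ≡ w (p ∷ q ∷ z ∷ σ) + (w (q ∷ p ∷ z ∷ σ) + Σins p (λ τ → w (q ∷ z ∷ τ)) σ)
    expand-front p q = trans (Σins-∷ p q w (z ∷ σ)) (cong (w (p ∷ q ∷ z ∷ σ) +_) (Σins-∷ p z (λ τ → w (q ∷ τ)) σ))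
    expand-back : ∀ p q → Σins q (λ τ → Σins p w (z ∷ τ)) σ ≡ Σins q (λ τ → w (p ∷ z ∷ τ)) σ + Σins q (Σins p (λ τ → w (z ∷ τ))) σ
    expand-back p q = trans (Σins-cong (λ τ → Σins-∷ p z w τ) q σ) (Σins-+ (λ τ → w (p ∷ z ∷ τ)) (Σins p (λ τ → w (z ∷ τ))) q σ)
    regroup : ∀ a b c d e → (a + (b + c)) + (d + e) ≡ (b + (a + d)) + (c + e)
    regroup = solve-∀

  Σperm-↭ : {xs ys : List A} → xs ↭ ys → (w : List A → ℕ) → Σperm w xs ≡ Σperm w ys
  Σperm-↭ ↭.refl w = refl
  Σperm-↭ {x ∷ xs} {x ∷ ys} (prep x p) w =
    trans (Σperm-∷ w x xs) (trans (Σperm-↭ p (Σins x w)) (sym (Σperm-∷ w x ys)))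
  Σperm-↭ {x ∷ y ∷ xs} {y ∷ x ∷ ys} (swap x y p) w = begin
      Σperm w (x ∷ y ∷ xs)
    ≡⟨ trans (Σperm-∷ w x (y ∷ xs)) (Σperm-∷ (Σins x w) y xs) ⟩
      Σperm (Σins y (Σins x w)) xs
    ≡⟨ Σperm-↭ p _ ⟩
      Σperm (Σins y (Σins x w)) ys
    ≡⟨ Σperm-cong (λ σ → Σins-comm x y σ w) ys ⟩
      Σperm (Σins x (Σins y w)) ys
    ≡⟨ sym (trans (Σperm-∷ w y (x ∷ ys)) (Σperm-∷ (Σins y w) x ys)) ⟩
      Σperm w (y ∷ x ∷ ys)
    ∎
    where open ≡-Reasoning
  Σperm-↭ (↭.trans p q) w = trans (Σperm-↭ p w) (Σperm-↭ q w)

  selections : List A → List (A × List A)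
  selections [] = []
  selections (x ∷ xs) = (x , xs) ∷ map (λ p → proj₁ p , x ∷ proj₂ p) (selections xs)

  length-selections : (L : List A) → length (selections L) ≡ length L
  length-selections [] = refl
  length-selections (x ∷ xs) = cong suc (trans (length-map _ (selections xs)) (length-selections xs))

  selections-All : {Q : A × List A → Set} (L : List A) → (∀ y r → L ↭ y ∷ r → Q (y , r)) →
    All Q (selections L)
  selections-All [] h = []
  selections-All {Q} (x ∷ xs) h = h x xs ↭.refl ∷
    All.map⁺ (selections-All {λ p → Q (proj₁ p , x ∷ proj₂ p)} xs
      (λ y r e → h y (x ∷ r) (↭.trans (prep x e) (swap x y ↭.refl))))
    where import Data.List.Relation.Unary.All.Properties as All

  Σperm-first : (w : List A → ℕ) (L : List A) → L ≢ [] →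
    Σperm w L ≡ sumBy (λ p → Σperm (λ σ → w (proj₁ p ∷ σ)) (proj₂ p)) (selections L)
  Σperm-first w [] L≢[] = ⊥-elim (L≢[] refl)
  Σperm-first w (x ∷ []) _ = sym (+-identityʳ _)
  Σperm-first w (x ∷ y ∷ ys) _ = begin
      Σperm w (x ∷ y ∷ ys)
    ≡⟨ Σperm-∷ w x (y ∷ ys) ⟩
      Σperm (Σins x w) (y ∷ ys)
    ≡⟨ Σperm-first (Σins x w) (y ∷ ys) (λ ()) ⟩
      sumBy (λ p → Σperm (λ σ → Σins x w (proj₁ p ∷ σ)) (proj₂ p)) Sel
    ≡⟨ sumBy-cong split Sel ⟩
      sumBy (λ p → xFirst p + xLater p) Sel
    ≡⟨ sumBy-+ xFirst xLater Sel ⟩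
      sumBy xFirst Sel + sumBy xLater Sel
    ≡⟨ cong₂ _+_ (sym (Σperm-first (λ σ → w (x ∷ σ)) (y ∷ ys) (λ ())))
                 (sumBy-cong (λ p → sym (Σperm-∷ (λ τ → w (proj₁ p ∷ τ)) x (proj₂ p))) Sel) ⟩
      Σperm (λ σ → w (x ∷ σ)) (y ∷ ys) + sumBy (λ p → Σperm (λ τ → w (proj₁ p ∷ τ)) (x ∷ proj₂ p)) Sel
    ≡⟨ cong (Σperm (λ σ → w (x ∷ σ)) (y ∷ ys) +_)
            (sym (sumBy-map (λ p → Σperm (λ σ → w (proj₁ p ∷ σ)) (proj₂ p)) (λ p → proj₁ p , x ∷ proj₂ p) Sel)) ⟩
      sumBy (λ p → Σperm (λ σ → w (proj₁ p ∷ σ)) (proj₂ p)) (selections (x ∷ y ∷ ys))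
    ∎
    where
    open ≡-Reasoning
    Sel = selections (y ∷ ys)
    -- orderings where x comes first, and where x comes after the first element
    xFirst xLater : A × List A → ℕ
    xFirst p = Σperm (λ σ → w (x ∷ proj₁ p ∷ σ)) (proj₂ p)
    xLater p = Σperm (Σins x (λ τ → w (proj₁ p ∷ τ))) (proj₂ p)
    split : ∀ p → Σperm (λ σ → Σins x w (proj₁ p ∷ σ)) (proj₂ p) ≡ xFirst p + xLater p
    split p = trans (Σperm-cong (λ σ → Σins-∷ x (proj₁ p) w σ) (proj₂ p))
                    (Σperm-+ (λ σ → w (x ∷ proj₁ p ∷ σ)) (Σins x (λ τ → w (proj₁ p ∷ τ))) (proj₂ p))

  Σperm-count : ∀ n (L : List A) → length L ≡ n → Σperm (λ _ → 1) L ≡ n !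
  Σperm-count zero [] _ = refl
  Σperm-count (suc n) L@(x ∷ xs) len = begin
      Σperm (λ _ → 1) L
    ≡⟨ Σperm-first (λ _ → 1) L (λ ()) ⟩
      sumBy (λ p → Σperm (λ _ → 1) (proj₂ p)) (selections L)
    ≡⟨ sym (*-identityʳ _) ⟩
      sumBy (λ p → Σperm (λ _ → 1) (proj₂ p)) (selections L) * 1
    ≡⟨ sumBy-uniform {f = λ p → Σperm (λ _ → 1) (proj₂ p)} {D = 1} (selections-All L (λ y r p →
         trans (*-identityʳ _) (Σperm-count n r (suc-injective (trans (sym (↭-length p)) len))))) ⟩
      length (selections L) * n !
    ≡⟨ cong (_* n !) (trans (length-selections L) len) ⟩
      suc n !
    ∎
    where open ≡-Reasoning

  sumBy-selections-++ : (g : A × List A → ℕ) (xs ys : List A) →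
    sumBy g (selections (xs ++ ys)) ≡
      sumBy (λ p → g (proj₁ p , proj₂ p ++ ys)) (selections xs) + sumBy (λ p → g (proj₁ p , xs ++ proj₂ p)) (selections ys)
  sumBy-selections-++ g [] ys = refl
  sumBy-selections-++ g (x ∷ xs) ys = begin
      g (x , xs ++ ys) + sumBy g (map h (selections (xs ++ ys)))
    ≡⟨ cong (g (x , xs ++ ys) +_) (trans (sumBy-map g h (selections (xs ++ ys))) (sumBy-selections-++ (λ p → g (h p)) xs ys)) ⟩
      g (x , xs ++ ys) + (sumBy (λ p → g (appendYs (h p))) (selections xs) + sumBy (λ p → g (h (proj₁ p , xs ++ proj₂ p))) (selections ys))
    ≡⟨ sym (+-assoc (g (x , xs ++ ys)) _ _) ⟩
      (g (x , xs ++ ys) + sumBy (λ p → g (appendYs (h p))) (selections xs)) + sumBy (λ p → g (h (proj₁ p , xs ++ proj₂ p))) (selections ys)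
    ≡⟨ cong (λ q → (g (x , xs ++ ys) + q) + sumBy (λ p → g (h (proj₁ p , xs ++ proj₂ p))) (selections ys))
            (sym (sumBy-map (λ p → g (appendYs p)) h (selections xs))) ⟩
      (g (x , xs ++ ys) + sumBy (λ p → g (appendYs p)) (map h (selections xs))) + sumBy (λ p → g (proj₁ p , x ∷ (xs ++ proj₂ p))) (selections ys)
    ∎
    where
    open ≡-Reasoning
    h appendYs : A × List A → A × List A
    h p = proj₁ p , x ∷ proj₂ p
    appendYs p = proj₁ p , proj₂ p ++ ys

sumBy-selections-map : {A B : Set} (f : A → B) (g : B × List B → ℕ) (xs : List A) →
  sumBy g (selections (map f xs)) ≡ sumBy (λ p → g (f (proj₁ p) , map f (proj₂ p))) (selections xs)
sumBy-selections-map f g [] = refl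
sumBy-selections-map f g (x ∷ xs) = cong (g (f x , map f xs) +_)
  (trans (sumBy-map g (λ p → proj₁ p , f x ∷ proj₂ p) (selections (map f xs)))
  (trans (sumBy-selections-map f (λ p → g (proj₁ p , f x ∷ proj₂ p)) xs)
  (sym (sumBy-map (λ p → g (f (proj₁ p) , map f (proj₂ p))) (λ p → proj₁ p , x ∷ proj₂ p) (selections xs)))))

insertions-↭ : ∀ {A : Set} (x : A) τ {σ} → σ ∈ insertions x τ → σ ↭ x ∷ τ
insertions-↭ x [] (here refl) = ↭.refl
insertions-↭ x (y ∷ ys) (here refl) = ↭.refl
insertions-↭ x (y ∷ ys) (there σ∈) with ∈-map⁻ (y ∷_) σ∈
... | σ' , σ'∈ , refl = ↭.trans (prep y (insertions-↭ x ys σ'∈)) (swap y x ↭.refl)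

perms-↭ : ∀ {A : Set} (L : List A) {σ} → σ ∈ perms L → σ ↭ L
perms-↭ [] (here refl) = ↭.refl
perms-↭ (x ∷ xs) σ∈ with find (∈-concatMap⁻ (insertions x) σ∈)
... | τ , τ∈ , σ∈' = ↭.trans (insertions-↭ x τ σ∈') (prep x (perms-↭ xs τ∈))

-- Sums over the orderings of  L ++ E  whose first element comes from L.
module _ {A : Set} where

  Σfirst : (List A → ℕ) → List A → List A → ℕ
  Σfirst w L E = sumBy (λ p → Σperm (λ σ → w (proj₁ p ∷ σ)) (proj₂ p ++ E)) (selections L)

  Σperm-by-first : (w : List A → ℕ) (L : List A) → L ≢ [] → Σperm w L ≡ Σfirst w L []
  Σperm-by-first w L L≢[] = trans (Σperm-first w L L≢[])
    (sumBy-cong (λ p → cong (Σperm (λ σ → w (proj₁ p ∷ σ))) (sym (++-identityʳ (proj₂ p)))) (selections L))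

  Σfirst-++ : (w : List A → ℕ) (xs ys E : List A) →
    Σfirst w (xs ++ ys) E ≡ Σfirst w xs (ys ++ E) + Σfirst w ys (xs ++ E)
  Σfirst-++ w xs ys E = trans (sumBy-selections-++ _ xs ys) (cong₂ _+_
    (sumBy-cong (λ p → cong (Σperm (λ σ → w (proj₁ p ∷ σ))) (++-assoc (proj₂ p) ys E)) (selections xs))
    (sumBy-cong (λ p → Σperm-↭ (move xs (proj₂ p) E) (λ σ → w (proj₁ p ∷ σ))) (selections ys)))
    where
    move : (xs r E : List A) → (xs ++ r) ++ E ↭ r ++ (xs ++ E)
    move = solve 3 (λ X R F → (X ⊕ R) ⊕ F ⊜ R ⊕ (X ⊕ F)) ↭.refl
      where open PermutationSolver

  Σfirst-uniform : {B : Set} (w : List A → ℕ) (f : B → A) (Vs : List B) (E : List A) {D K : ℕ} →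
    (∀ v r → Vs ↭ v ∷ r → Σperm (λ σ → w (f v ∷ σ)) (map f r ++ E) * D ≡ K) →
    Σfirst w (map f Vs) E * D ≡ length Vs * K
  Σfirst-uniform {B} w f Vs E {D} {K} h = begin
      Σfirst w (map f Vs) E * D
    ≡⟨ cong (_* D) (sumBy-selections-map f _ Vs) ⟩
      sumBy term (selections Vs) * D
    ≡⟨ sumBy-uniform {f = term} (selections-All Vs h) ⟩
      length (selections Vs) * K
    ≡⟨ cong (_* K) (length-selections Vs) ⟩
      length Vs * K
    ∎
    where
    open ≡-Reasoning
    term : B × List B → ℕ
    term p = Σperm (λ σ → w (f (proj₁ p) ∷ σ)) (map f (proj₂ p) ++ E)

  Σfirst-vanishes : {B : Set} (w : List A → ℕ) (f : B → A) (Vs : List B) (E : List A) →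
    (∀ v r → Vs ↭ v ∷ r → Σperm (λ σ → w (f v ∷ σ)) (map f r ++ E) ≡ 0) →
    Σfirst w (map f Vs) E ≡ 0
  Σfirst-vanishes w f Vs E h = trans (sumBy-selections-map f _ Vs) (sumBy-vanishes (selections-All Vs h))

true≢false : {b : Bool} → b ≡ true → b ≡ false → ⊥
true≢false refl ()

∨-split : ∀ a {b} → (a ∨ b) ≡ true → a ≡ true ⊎ b ≡ true
∨-split true e = inj₁ refl
∨-split false e = inj₂ e

∧-split : ∀ a {b} → (a ∧ b) ≡ true → (a ≡ true) × (b ≡ true)
∧-split true e = refl , e

∨-trueʳ : ∀ a {b} → b ≡ true → (a ∨ b) ≡ true
∨-trueʳ a refl = ∨-zeroʳ a

∨-false : ∀ {a b} → a ≡ false → b ≡ false → (a ∨ b) ≡ false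
∨-false refl e = e

≡ᵇ-refl : ∀ x → (x ≡ᵇ x) ≡ true
≡ᵇ-refl zero = refl
≡ᵇ-refl (suc x) = ≡ᵇ-refl x

≡ᵇ-true : ∀ {x y} → (x ≡ᵇ y) ≡ true → x ≡ y
≡ᵇ-true {x} {y} e = ≡ᵇ⇒≡ x y (subst T (sym e) _)

≡ᵇ-false : ∀ {x y} → x ≢ y → (x ≡ᵇ y) ≡ false
≡ᵇ-false {x} {y} x≢y with x ≡ᵇ y in e
... | true = ⊥-elim (x≢y (≡ᵇ-true e))
... | false = refl

seen≢unseen : ∀ {x y} S → x ∈ᵇ S ≡ true → y ∈ᵇ S ≡ false → x ≢ y
seen≢unseen S t f refl = true≢false t f

∈ᵇ-head : ∀ c S → c ∈ᵇ (c ∷ S) ≡ true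
∈ᵇ-head c S rewrite ≡ᵇ-refl c = refl

∈ᵇ-second : ∀ c a S → a ∈ᵇ (c ∷ a ∷ S) ≡ true
∈ᵇ-second c a S = ∨-trueʳ (c ≡ᵇ a) (∈ᵇ-head a S)

∈ᵇ-keep : ∀ c a S x → x ∈ᵇ S ≡ true → x ∈ᵇ (c ∷ a ∷ S) ≡ true
∈ᵇ-keep c a S x e = ∨-trueʳ (c ≡ᵇ x) (∨-trueʳ (a ≡ᵇ x) e)

∈ᵇ-fresh : ∀ c a S x → c ≢ x → a ≢ x → x ∈ᵇ S ≡ false → x ∈ᵇ (c ∷ a ∷ S) ≡ false
∈ᵇ-fresh c a S x c≢x a≢x e = ∨-false (≡ᵇ-false c≢x) (∨-false (≡ᵇ-false a≢x) e)

∈ᵇ-∷⁻ : ∀ a L y → y ∈ᵇ (a ∷ L) ≡ true → a ≡ y ⊎ y ∈ᵇ L ≡ true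
∈ᵇ-∷⁻ a L y e with ∨-split (a ≡ᵇ y) e
... | inj₁ e' = inj₁ (≡ᵇ-true e')
... | inj₂ e' = inj₂ e'

∈ᵇ-shrink : ∀ c a S y → y ∈ᵇ (c ∷ a ∷ S) ≡ false → y ∈ᵇ S ≡ false
∈ᵇ-shrink c a S y e = ∨-falseʳ (a ≡ᵇ y) (∨-falseʳ (c ≡ᵇ y) e)
  where
  ∨-falseʳ : ∀ p {q} → (p ∨ q) ≡ false → q ≡ false
  ∨-falseʳ false f = f

-- Centres and leaves.  All graphs below have centres 0 and 1 and every edge
-- is written (centre , leaf) with leaf ≥ 2.

centre-cases : ∀ {x} → x ≤ 1 → x ≡ 0 ⊎ x ≡ 1
centre-cases z≤n = inj₁ refl
centre-cases (s≤s z≤n) = inj₂ refl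

centre≢leaf : ∀ {x v} → x ≤ 1 → 2 ≤ v → x ≢ v
centre≢leaf z≤n (s≤s (s≤s _)) ()
centre≢leaf (s≤s z≤n) (s≤s (s≤s _)) ()

other : ℕ → ℕ
other x = 1 ∸ x

-- The process on a graph with two centres, recast as a decision procedure.
-- joins S σ  tells whether, continuing the process on the edges σ when the
-- vertices in S have been seen, the two centres end up in one tree.  The
-- first edge (x , y) at an unseen centre x is always kept; if its leaf y was
-- already seen (necessarily through the other centre) it joins the centres,
-- while if the other centre was already seen nothing can join them any more
-- (a later kept edge needs an unseen leaf, whose other edge then comes too late).
joins : List ℕ → List Edge → Bool
joins S [] = false
joins S ((x , y) ∷ es) =
  if x ∈ᵇ S then joins (x ∷ y ∷ S) es
  else (if y ∈ᵇ S then true else (if other x ∈ᵇ S then false else joins (x ∷ y ∷ S) es))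

𝟙 : Bool → ℕ
𝟙 true = 1
𝟙 false = 0

joinCount : List ℕ → List Edge → ℕ
joinCount S L = Σperm (λ σ → 𝟙 (joins S σ)) L

joins-seen : ∀ {x S} y σ → x ∈ᵇ S ≡ true → joins S ((x , y) ∷ σ) ≡ joins (x ∷ y ∷ S) σ
joins-seen y σ x∈S rewrite x∈S = refl

joins-closes : ∀ {x S} y σ → x ∈ᵇ S ≡ false → y ∈ᵇ S ≡ true → joins S ((x , y) ∷ σ) ≡ true
joins-closes y σ x∉S y∈S rewrite x∉S | y∈S = refl

joins-blocked : ∀ {x S} y σ → x ∈ᵇ S ≡ false → y ∈ᵇ S ≡ false → other x ∈ᵇ S ≡ true →
  joins S ((x , y) ∷ σ) ≡ false
joins-blocked y σ x∉S y∉S o∈S rewrite x∉S | y∉S | o∈S = refl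

length-map-++ : ∀ {A B : Set} (f : A → B) xs (R : List B) → length (map f xs ++ R) ≡ length xs + length R
length-map-++ f xs R = trans (length-++ (map f xs)) (cong (_+ length R) (length-map f xs))

-- Counting joining orderings once exactly one centre has been seen.  The seen
-- centre is c, the unseen one c'.  The pending edges are described by four
-- lists of leaves: As (leaves of c only), Ms (shared leaves with both edges
-- pending), Ks (shared leaves whose c-edge is already processed) and Js
-- (leaves of c' only).
module Counting (c c' : ℕ) where

  pending : List ℕ → List ℕ → List ℕ → List ℕ → List Edge
  pending As Ms Ks Js =
    map (c ,_) As ++ (map (c ,_) Ms ++ (map (c' ,_) Ms ++ (map (c' ,_) Ks ++ map (c' ,_) Js)))

  size : List ℕ → List ℕ → List ℕ → List ℕ → ℕ
  size As Ms Ks Js = length As + (length Ms + (length Ms + (length Ks + length Js)))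

  length-pending : ∀ As Ms Ks Js → length (pending As Ms Ks Js) ≡ size As Ms Ks Js
  length-pending As Ms Ks Js =
    trans (length-map-++ (c ,_) As _) (cong (length As +_)
    (trans (length-map-++ (c ,_) Ms _) (cong (length Ms +_)
    (trans (length-map-++ (c' ,_) Ms _) (cong (length Ms +_)
    (trans (length-map-++ (c' ,_) Ks _) (cong (length Ks +_) (length-map (c' ,_) Js))))))))

  degree : List ℕ → List ℕ → List ℕ → ℕ
  degree Ms Ks Js = length Ms + (length Ks + length Js)

  record HalfSeen (S As Ms Ks Js : List ℕ) : Set where
    field
      c-seen : c ∈ᵇ S ≡ true
      c'-unseen : c' ∈ᵇ S ≡ false
      c-other : other c' ≡ c
      Ks-seen : All (λ v → v ∈ᵇ S ≡ true) Ks
      MJs-unseen : All (λ v → v ∈ᵇ S ≡ false) (Ms ++ Js)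
      unique : Unique (As ++ (Ms ++ Js))
      c'-∉ : All (c' ≢_) (As ++ (Ms ++ Js))

  module _ {S As Ms Ks Js} (hs : HalfSeen S As Ms Ks Js) where
    open HalfSeen hs

    private
      stillUnseen : ∀ {v Xs} → v ∉ Xs → All (λ x → x ∈ᵇ S ≡ false) Xs → All (λ x → x ∈ᵇ (c ∷ v ∷ S) ≡ false) Xs
      stillUnseen {v} {Xs} v∉ unseen = All.tabulate (λ {x} x∈ →
        ∈ᵇ-fresh c v S x (seen≢unseen S c-seen (All.lookup unseen x∈)) (λ v≡x → v∉ (subst (_∈ Xs) (sym v≡x) x∈))
          (All.lookup unseen x∈))

      c'-stillUnseen : ∀ {v} → c' ≢ v → c' ∈ᵇ (c ∷ v ∷ S) ≡ false
      c'-stillUnseen {v} c'≢v = ∈ᵇ-fresh c v S c' (seen≢unseen S c-seen c'-unseen) (λ e → c'≢v (sym e)) c'-unseen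

    afterA : ∀ {a As'} → As ↭ a ∷ As' → HalfSeen (c ∷ a ∷ S) As' Ms Ks Js
    afterA {a} {As'} p = record
      { c-seen = ∈ᵇ-head c (a ∷ S)
      ; c'-unseen = c'-stillUnseen (All.head (All-resp-↭ q c'-∉))
      ; c-other = c-other
      ; Ks-seen = All.map (λ {k} → ∈ᵇ-keep c a S k) Ks-seen
      ; MJs-unseen = stillUnseen (λ a∈ → Unique[x∷xs]⇒x∉xs u (∈-++⁺ʳ As' a∈)) MJs-unseen
      ; unique = AllPairs.tail u
      ; c'-∉ = All.tail (All-resp-↭ q c'-∉)
      }
      where
      q : As ++ (Ms ++ Js) ↭ a ∷ (As' ++ (Ms ++ Js))
      q = ++⁺ʳ (Ms ++ Js) p
      u = Unique-↭ q unique

    afterM : ∀ {m Ms'} → Ms ↭ m ∷ Ms' → HalfSeen (c ∷ m ∷ S) As Ms' (m ∷ Ks) Js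
    afterM {m} {Ms'} p = record
      { c-seen = ∈ᵇ-head c (m ∷ S)
      ; c'-unseen = c'-stillUnseen (All.head (All-resp-↭ q c'-∉))
      ; c-other = c-other
      ; Ks-seen = ∈ᵇ-second c m S ∷ All.map (λ {k} → ∈ᵇ-keep c m S k) Ks-seen
      ; MJs-unseen = stillUnseen (λ m∈ → Unique[x∷xs]⇒x∉xs u (∈-++⁺ʳ As m∈))
                       (All.tail (All-resp-↭ (++⁺ʳ Js p) MJs-unseen))
      ; unique = AllPairs.tail u
      ; c'-∉ = All.tail (All-resp-↭ q c'-∉)
      }
      where
      q : As ++ (Ms ++ Js) ↭ m ∷ (As ++ (Ms' ++ Js))
      q = ↭.trans (++⁺ˡ As (++⁺ʳ Js p)) (shift m As (Ms' ++ Js))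
      u = Unique-↭ q unique

  JoinFraction : ℕ → List ℕ → List ℕ → List ℕ → List ℕ → List ℕ → Set
  JoinFraction n S As Ms Ks Js =
    joinCount S (pending As Ms Ks Js) * (d * suc d) ≡ n ! * (length Ks * suc d + length Ms)
    where d = degree Ms Ks Js

  -- the arithmetic of one step: summing the contributions of the five kinds
  -- of first edge (the two kinds of edge at c' to unseen leaves contribute 0)
  step-arithmetic : ∀ a m k j F → let d = m + (k + j) in
    a * (F * (k * suc d + m)) + (m * (F * (suc k * suc d + pred m)) + (0 + (k * (F * (d * suc d)) + 0)))
    ≡ (a + (m + (m + (k + j)))) * F * (k * suc d + m)
  step-arithmetic a zero k j F = identity a k j F
    where
    identity : ∀ a k j F → a * (F * (k * suc (0 + (k + j)) + 0)) + (0 * (F * (suc k * suc (0 + (k + j)) + 0)) + (0 + (k * (F * ((0 + (k + j)) * suc (0 + (k + j)))) + 0)))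
      ≡ (a + (0 + (0 + (k + j)))) * F * (k * suc (0 + (k + j)) + 0)
    identity = solve-∀
  step-arithmetic a (suc m) k j F = identity a m k j F
    where
    identity : ∀ a m k j F → a * (F * (k * suc (suc m + (k + j)) + suc m)) + (suc m * (F * (suc k * suc (suc m + (k + j)) + m)) + (0 + (k * (F * ((suc m + (k + j)) * suc (suc m + (k + j)))) + 0)))
      ≡ (a + (suc m + (suc m + (k + j)))) * F * (k * suc (suc m + (k + j)) + suc m)
    identity = solve-∀

  -- One step of the recursion on the number of pending edges: classify the
  -- orderings by their first edge, which is  (c , a)  for a ∈ As,  (c , m)  or
  -- (c' , m)  for m ∈ Ms,  (c' , k)  for k ∈ Ks, or  (c' , j)  for j ∈ Js.
  module Step (n : ℕ)
    (IH : ∀ S As Ms Ks Js → HalfSeen S As Ms Ks Js → size As Ms Ks Js ≡ n → JoinFraction n S As Ms Ks Js)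
    {S As Ms Ks Js : List ℕ} (hs : HalfSeen S As Ms Ks Js) (len : size As Ms Ks Js ≡ suc n) where

    open HalfSeen hs
    open ≡-Reasoning
    open PermutationSolver

    w : List Edge → ℕ
    w σ = 𝟙 (joins S σ)

    a m k j d D : ℕ
    a = length As
    m = length Ms
    k = length Ks
    j = length Js
    d = degree Ms Ks Js
    D = d * suc d

    XA XM XM' XK XJ : List Edge
    XA = map (c ,_) As
    XM = map (c ,_) Ms
    XM' = map (c' ,_) Ms
    XK = map (c' ,_) Ks
    XJ = map (c' ,_) Js

    other-seen : other c' ∈ᵇ S ≡ true
    other-seen = trans (cong (_∈ᵇ S) c-other) c-seen

    pending≢[] : pending As Ms Ks Js ≢ []
    pending≢[] e with trans (sym (cong length e)) (trans (length-pending As Ms Ks Js) len)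
    ... | ()

    split : joinCount S (pending As Ms Ks Js) ≡
      Σfirst w XA ((XM ++ (XM' ++ (XK ++ XJ))) ++ [])
      + (Σfirst w XM ((XM' ++ (XK ++ XJ)) ++ (XA ++ []))
      + (Σfirst w XM' ((XK ++ XJ) ++ (XM ++ (XA ++ [])))
      + (Σfirst w XK (XJ ++ (XM' ++ (XM ++ (XA ++ []))))
      + Σfirst w XJ (XK ++ (XM' ++ (XM ++ (XA ++ [])))))))
    split =
      trans (Σperm-by-first w (pending As Ms Ks Js) pending≢[])
      (trans (Σfirst-++ w XA (XM ++ (XM' ++ (XK ++ XJ))) [])
      (cong (Σfirst w XA ((XM ++ (XM' ++ (XK ++ XJ))) ++ []) +_)
        (trans (Σfirst-++ w XM (XM' ++ (XK ++ XJ)) (XA ++ []))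
        (cong (Σfirst w XM ((XM' ++ (XK ++ XJ)) ++ (XA ++ [])) +_)
          (trans (Σfirst-++ w XM' (XK ++ XJ) (XM ++ (XA ++ [])))
          (cong (Σfirst w XM' ((XK ++ XJ) ++ (XM ++ (XA ++ []))) +_)
            (Σfirst-++ w XK XJ (XM' ++ (XM ++ (XA ++ []))))))))))

    viaA : ∀ E → E ↭ XM ++ (XM' ++ (XK ++ XJ)) → Σfirst w XA E * D ≡ a * (n ! * (k * suc d + m))
    viaA E E↭ = Σfirst-uniform w (c ,_) As E (λ a₀ As' p → begin
        Σperm (λ σ → w ((c , a₀) ∷ σ)) (map (c ,_) As' ++ E) * D
      ≡⟨ cong (_* D) (Σperm-cong (λ σ → cong 𝟙 (joins-seen {c} {S} a₀ σ c-seen)) (map (c ,_) As' ++ E)) ⟩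
        joinCount (c ∷ a₀ ∷ S) (map (c ,_) As' ++ E) * D
      ≡⟨ cong (_* D) (Σperm-↭ (++⁺ˡ (map (c ,_) As') E↭) _) ⟩
        joinCount (c ∷ a₀ ∷ S) (pending As' Ms Ks Js) * D
      ≡⟨ IH _ As' Ms Ks Js (afterA hs p) (suc-injective (trans (cong (_+ _) (sym (↭-length p))) len)) ⟩
        n ! * (k * suc d + m)
      ∎)

    viaM : ∀ E → E ↭ XA ++ (XM' ++ (XK ++ XJ)) → Σfirst w XM E * D ≡ m * (n ! * (suc k * suc d + pred m))
    viaM E E↭ = Σfirst-uniform w (c ,_) Ms E (λ m₀ Ms' p →
      let ℓ = ↭-length p
          d≡ : degree Ms' (m₀ ∷ Ks) Js ≡ d
          d≡ = trans (+-suc (length Ms') (k + j)) (cong (_+ (k + j)) (sym ℓ))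
      in begin
        Σperm (λ σ → w ((c , m₀) ∷ σ)) (map (c ,_) Ms' ++ E) * D
      ≡⟨ cong (_* D) (Σperm-cong (λ σ → cong 𝟙 (joins-seen {c} {S} m₀ σ c-seen)) (map (c ,_) Ms' ++ E)) ⟩
        joinCount (c ∷ m₀ ∷ S) (map (c ,_) Ms' ++ E) * D
      ≡⟨ cong (_* D) (Σperm-↭ (rearrange m₀ Ms' p) _) ⟩
        joinCount (c ∷ m₀ ∷ S) (pending As Ms' (m₀ ∷ Ks) Js) * D
      ≡⟨ cong (λ e → joinCount (c ∷ m₀ ∷ S) (pending As Ms' (m₀ ∷ Ks) Js) * (e * suc e)) (sym d≡) ⟩
        joinCount (c ∷ m₀ ∷ S) (pending As Ms' (m₀ ∷ Ks) Js) * (degree Ms' (m₀ ∷ Ks) Js * suc (degree Ms' (m₀ ∷ Ks) Js))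
      ≡⟨ IH _ As Ms' (m₀ ∷ Ks) Js (afterM hs p) (size-after (length Ms') (trans (cong (λ e → a + (e + (e + (k + j)))) (sym ℓ)) len)) ⟩
        n ! * (suc k * suc (degree Ms' (m₀ ∷ Ks) Js) + length Ms')
      ≡⟨ cong₂ (λ e f → n ! * (suc k * suc e + f)) d≡ (cong pred (sym ℓ)) ⟩
        n ! * (suc k * suc d + pred m)
      ∎)
      where
      rearrange : ∀ m₀ Ms' → Ms ↭ m₀ ∷ Ms' → map (c ,_) Ms' ++ E ↭ pending As Ms' (m₀ ∷ Ks) Js
      rearrange m₀ Ms' p = ↭.trans (++⁺ˡ (map (c ,_) Ms') (↭.trans E↭ (++⁺ˡ XA (++⁺ʳ (XK ++ XJ) (map⁺ (c' ,_) p)))))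
        (solve 5 (λ P A Y Q R → P ⊕ (A ⊕ ((Y ⊕ Q) ⊕ R)) ⊜ A ⊕ (P ⊕ (Q ⊕ (Y ⊕ R)))) ↭.refl
          (map (c ,_) Ms') XA [ (c' , m₀) ] (map (c' ,_) Ms') (XK ++ XJ))
      size-after : ∀ m' → a + (suc m' + (suc m' + (k + j))) ≡ suc n → a + (m' + (m' + (suc k + j))) ≡ n
      size-after m' e = suc-injective (trans (shuffle a m' k j) e)
        where
        shuffle : ∀ a m k j → suc (a + (m + (m + (suc k + j)))) ≡ a + (suc m + (suc m + (k + j)))
        shuffle = solve-∀

    -- first edge (c' , k₀) with k₀ already seen: every such ordering joins
    viaK : ∀ E → E ↭ XA ++ (XM ++ (XM' ++ XJ)) → Σfirst w XK E * D ≡ k * (n ! * D)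
    viaK E E↭ = Σfirst-uniform w (c' ,_) Ks E (λ k₀ Ks' p → cong (_* D) (begin
        Σperm (λ σ → w ((c' , k₀) ∷ σ)) (map (c' ,_) Ks' ++ E)
      ≡⟨ Σperm-cong (λ σ → cong 𝟙 (joins-closes {c'} {S} k₀ σ c'-unseen (All.lookup Ks-seen (∈-resp-↭ (↭-sym p) (here refl))))) (map (c' ,_) Ks' ++ E) ⟩
        Σperm (λ _ → 1) (map (c' ,_) Ks' ++ E)
      ≡⟨ Σperm-count n (map (c' ,_) Ks' ++ E) (trans (↭-length (rearrange Ks')) (trans (length-pending As Ms Ks' Js) (size-after k₀ Ks' p))) ⟩
        n !
      ∎))
      where
      rearrange : ∀ Ks' → map (c' ,_) Ks' ++ E ↭ pending As Ms Ks' Js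
      rearrange Ks' = ↭.trans (++⁺ˡ (map (c' ,_) Ks') E↭)
        (solve 5 (λ K A M M' J → K ⊕ (A ⊕ (M ⊕ (M' ⊕ J))) ⊜ A ⊕ (M ⊕ (M' ⊕ (K ⊕ J)))) ↭.refl
          (map (c' ,_) Ks') XA XM XM' XJ)
      size-after : ∀ k₀ Ks' → Ks ↭ k₀ ∷ Ks' → size As Ms Ks' Js ≡ n
      size-after k₀ Ks' p = suc-injective (trans (shuffle a m (length Ks') j)
        (trans (cong (λ e → a + (m + (m + (e + j)))) (sym (↭-length p))) len))
        where
        shuffle : ∀ a m k j → suc (a + (m + (m + (k + j)))) ≡ a + (m + (m + (suc k + j)))
        shuffle = solve-∀

    -- first edge (c' , v) with v unseen: since c is seen, the centres never join
    viaUnseen : ∀ Vs E → All (λ v → v ∈ᵇ S ≡ false) Vs → Σfirst w (map (c' ,_) Vs) E ≡ 0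
    viaUnseen Vs E unseen = Σfirst-vanishes w (c' ,_) Vs E (λ v r p →
      trans (Σperm-cong (λ σ → cong 𝟙 (joins-blocked {c'} {S} v σ c'-unseen
                          (All.lookup unseen (∈-resp-↭ (↭-sym p) (here refl))) other-seen))
                        (map (c' ,_) r ++ E))
            (Σperm-zero (map (c' ,_) r ++ E)))

    joinFraction-step : JoinFraction (suc n) S As Ms Ks Js
    joinFraction-step = begin
        joinCount S (pending As Ms Ks Js) * D
      ≡⟨ cong (_* D) split ⟩
        (sA + (sM + (sM' + (sK + sJ)))) * D
      ≡⟨ distribute sA sM sM' sK sJ D ⟩
        sA * D + (sM * D + (sM' * D + (sK * D + sJ * D)))
      ≡⟨ cong₂ _+_ (viaA _ (perm₁ XM XM' XK XJ))
           (cong₂ _+_ (viaM _ (perm₂ XA XM' XK XJ))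
             (cong₂ _+_ (cong (_* D) (viaUnseen Ms _ (All.++⁻ˡ Ms MJs-unseen)))
               (cong₂ _+_ (viaK _ (perm₃ XA XM XM' XJ))
                 (cong (_* D) (viaUnseen Js _ (All.++⁻ʳ Ms MJs-unseen)))))) ⟩
        a * (n ! * (k * suc d + m)) + (m * (n ! * (suc k * suc d + pred m)) + (0 + (k * (n ! * D) + 0)))
      ≡⟨ step-arithmetic a m k j (n !) ⟩
        (a + (m + (m + (k + j)))) * n ! * (k * suc d + m)
      ≡⟨ cong (λ e → e * n ! * (k * suc d + m)) len ⟩
        suc n ! * (k * suc d + m)
      ∎
      where
      import Data.List.Relation.Unary.All.Properties as All
      sA = Σfirst w XA ((XM ++ (XM' ++ (XK ++ XJ))) ++ [])
      sM = Σfirst w XM ((XM' ++ (XK ++ XJ)) ++ (XA ++ []))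
      sM' = Σfirst w XM' ((XK ++ XJ) ++ (XM ++ (XA ++ [])))
      sK = Σfirst w XK (XJ ++ (XM' ++ (XM ++ (XA ++ []))))
      sJ = Σfirst w XJ (XK ++ (XM' ++ (XM ++ (XA ++ []))))
      distribute : ∀ p q r s t D → (p + (q + (r + (s + t)))) * D ≡ p * D + (q * D + (r * D + (s * D + t * D)))
      distribute = solve-∀
      perm₁ : ∀ M M' K J → (M ++ (M' ++ (K ++ J))) ++ [] ↭ M ++ (M' ++ (K ++ J))
      perm₁ = solve 4 (λ M M' K J → (M ⊕ (M' ⊕ (K ⊕ J))) ⊕ id ⊜ M ⊕ (M' ⊕ (K ⊕ J))) ↭.refl
      perm₂ : ∀ A M' K J → (M' ++ (K ++ J)) ++ (A ++ []) ↭ A ++ (M' ++ (K ++ J))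
      perm₂ = solve 4 (λ A M' K J → (M' ⊕ (K ⊕ J)) ⊕ (A ⊕ id) ⊜ A ⊕ (M' ⊕ (K ⊕ J))) ↭.refl
      perm₃ : ∀ A M M' J → J ++ (M' ++ (M ++ (A ++ []))) ↭ A ++ (M ++ (M' ++ J))
      perm₃ = solve 4 (λ A M M' J → J ⊕ (M' ⊕ (M ⊕ (A ⊕ id))) ⊜ A ⊕ (M ⊕ (M' ⊕ J))) ↭.refl

  joinFraction : ∀ n S As Ms Ks Js → HalfSeen S As Ms Ks Js → size As Ms Ks Js ≡ n → JoinFraction n S As Ms Ks Js
  joinFraction zero S [] [] [] [] _ _ = refl
  joinFraction zero S (_ ∷ _) _ _ _ _ ()
  joinFraction zero S [] (_ ∷ _) _ _ _ ()
  joinFraction zero S [] [] (_ ∷ _) _ _ ()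
  joinFraction zero S [] [] [] (_ ∷ _) _ ()
  joinFraction (suc n) S As Ms Ks Js hs len = Step.joinFraction-step n (joinFraction n) hs len

  afterFirst : ∀ {v As Ms Ks Js} → c ≤ 1 → c' ≤ 1 → c ≢ c' → other c' ≡ c → All (_≡ v) Ks →
    Unique (v ∷ (As ++ (Ms ++ Js))) → All (2 ≤_) (v ∷ (As ++ (Ms ++ Js))) →
    HalfSeen (c ∷ v ∷ []) As Ms Ks Js
  afterFirst {v} {As} c≤1 c'≤1 c≢c' c-other Ks≡v unique leaves = record
    { c-seen = ∈ᵇ-head c (v ∷ [])
    ; c'-unseen = ∈ᵇ-fresh c v [] c' c≢c' (λ v≡c' → centre≢leaf c'≤1 (All.head leaves) (sym v≡c')) refl
    ; c-other = c-other
    ; Ks-seen = All.map (λ {k} k≡v → subst (λ x → x ∈ᵇ (c ∷ v ∷ []) ≡ true) (sym k≡v) (∈ᵇ-second c v [])) Ks≡v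
    ; MJs-unseen = All.tabulate (λ {x} x∈ →
        ∈ᵇ-fresh c v [] x (centre≢leaf c≤1 (All.lookup (All.tail leaves) (∈-++⁺ʳ As x∈)))
          (λ v≡x → Unique[x∷xs]⇒x∉xs unique (subst (_∈ _) (sym v≡x) (∈-++⁺ʳ As x∈))) refl)
    ; unique = AllPairs.tail unique
    ; c'-∉ = All.map (centre≢leaf c'≤1) (All.tail leaves)
    }

starEdges : List ℕ → List ℕ → List ℕ → List Edge
starEdges As Bs Cs = Counting.pending 0 1 As Bs [] Cs

pronic : ℕ → ℕ
pronic x = x * suc x

start-arithmetic : ∀ a β c F → let P₀ = pronic (β + c); P₁ = pronic (β + a) in
  (a * (F * β)) * P₁ + ((β * (F * (suc (β + c) + pred β))) * P₁
    + ((β * (F * (suc (β + a) + pred β))) * P₀ + (c * (F * β)) * P₀))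
  ≡ (a + (β + (β + c))) * F * (β * (P₀ + P₁))
start-arithmetic a zero c F = identity a c F
  where
  identity : ∀ a c F → (a * (F * 0)) * ((0 + a) * suc (0 + a)) + ((0 * (F * (suc (0 + c) + 0))) * ((0 + a) * suc (0 + a))
    + ((0 * (F * (suc (0 + a) + 0))) * ((0 + c) * suc (0 + c)) + (c * (F * 0)) * ((0 + c) * suc (0 + c))))
    ≡ (a + (0 + (0 + c))) * F * (0 * ((0 + c) * suc (0 + c) + (0 + a) * suc (0 + a)))
  identity = solve-∀
start-arithmetic a (suc b) c F = identity a b c F
  where
  identity : ∀ a b c F → let P₀ = (suc b + c) * suc (suc b + c); P₁ = (suc b + a) * suc (suc b + a) in
    (a * (F * suc b)) * P₁ + ((suc b * (F * (suc (suc b + c) + b))) * P₁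
    + ((suc b * (F * (suc (suc b + a) + b))) * P₀ + (c * (F * suc b)) * P₀))
    ≡ (a + (suc b + (suc b + c))) * F * (suc b * (P₀ + P₁))
  identity = solve-∀

-- The first step: classify all orderings of a star by their first edge,
-- (0 , a), (0 , m), (1 , m) or (1 , z) for a ∈ As, m ∈ Bs, z ∈ Cs.  After it
-- exactly one centre is seen and the counting above applies.
module Start (As Bs Cs : List ℕ) (unique : Unique (As ++ (Bs ++ Cs))) (leaves : All (2 ≤_) (As ++ (Bs ++ Cs)))
  {n : ℕ} (len : Counting.size 0 1 As Bs [] Cs ≡ suc n) where

  open ≡-Reasoning
  open PermutationSolver
  module C₀ = Counting 0 1
  module C₁ = Counting 1 0

  w : List Edge → ℕ
  w σ = 𝟙 (joins [] σ)

  a β c : ℕ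
  a = length As
  β = length Bs
  c = length Cs

  XA XB₀ XB₁ XC : List Edge
  XA = map (0 ,_) As
  XB₀ = map (0 ,_) Bs
  XB₁ = map (1 ,_) Bs
  XC = map (1 ,_) Cs

  leavesAfter : ∀ {v Xs} → As ++ (Bs ++ Cs) ↭ v ∷ Xs → Unique (v ∷ Xs) × All (2 ≤_) (v ∷ Xs)
  leavesAfter q = Unique-↭ q unique , All-resp-↭ q leaves

  sharedDegree : ∀ {m₀ Bs'} x → Bs ↭ m₀ ∷ Bs' → Counting.degree 0 1 Bs' (m₀ ∷ []) x ≡ β + length x
  sharedDegree {m₀} {Bs'} x p = trans (+-suc (length Bs') (length x)) (cong (_+ length x) (sym (↭-length p)))

  fromA : ∀ E → E ↭ XB₀ ++ (XB₁ ++ XC) → Σfirst w XA E * pronic (β + c) ≡ a * (n ! * β)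
  fromA E E↭ = Σfirst-uniform w (0 ,_) As E (λ a₀ As' p →
    let (u , l) = leavesAfter (++⁺ʳ (Bs ++ Cs) p) in begin
      joinCount (0 ∷ a₀ ∷ []) (map (0 ,_) As' ++ E) * pronic (β + c)
    ≡⟨ cong (_* pronic (β + c)) (Σperm-↭ (++⁺ˡ (map (0 ,_) As') E↭) _) ⟩
      joinCount (0 ∷ a₀ ∷ []) (C₀.pending As' Bs [] Cs) * pronic (β + c)
    ≡⟨ C₀.joinFraction n _ As' Bs [] Cs (C₀.afterFirst z≤n (s≤s z≤n) (λ ()) refl [] u l)
         (suc-injective (trans (cong (_+ _) (sym (↭-length p))) len)) ⟩
      n ! * β
    ∎)

  fromC : ∀ E → E ↭ XB₁ ++ (XB₀ ++ XA) → Σfirst w XC E * pronic (β + a) ≡ c * (n ! * β)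
  fromC E E↭ = Σfirst-uniform w (1 ,_) Cs E (λ z₀ Cs' p →
    let (u , l) = leavesAfter (↭.trans (++⁺ˡ As (++⁺ˡ Bs p))
                    (solve 4 (λ A B Z C → A ⊕ (B ⊕ (Z ⊕ C)) ⊜ Z ⊕ (C ⊕ (B ⊕ A))) ↭.refl As Bs [ z₀ ] Cs')) in begin
      joinCount (1 ∷ z₀ ∷ []) (map (1 ,_) Cs' ++ E) * pronic (β + a)
    ≡⟨ cong (_* pronic (β + a)) (Σperm-↭ (++⁺ˡ (map (1 ,_) Cs') E↭) _) ⟩
      joinCount (1 ∷ z₀ ∷ []) (C₁.pending Cs' Bs [] As) * pronic (β + a)
    ≡⟨ C₁.joinFraction n _ Cs' Bs [] As (C₁.afterFirst (s≤s z≤n) z≤n (λ ()) refl [] u l)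
         (suc-injective (trans (size-shuffle (length Cs') β a) (trans (cong (λ e → a + (β + (β + e))) (sym (↭-length p))) len))) ⟩
      n ! * β
    ∎)
    where
    size-shuffle : ∀ c β a → suc (c + (β + (β + a))) ≡ a + (β + (β + suc c))
    size-shuffle = solve-∀

  fromB₀ : ∀ E → E ↭ XA ++ (XB₁ ++ XC) → Σfirst w XB₀ E * pronic (β + c) ≡ β * (n ! * (suc (β + c) + pred β))
  fromB₀ E E↭ = Σfirst-uniform w (0 ,_) Bs E (λ m₀ Bs' p →
    let (u , l) = leavesAfter (↭.trans (++⁺ˡ As (++⁺ʳ Cs p))
                    (solve 4 (λ A M B C → A ⊕ ((M ⊕ B) ⊕ C) ⊜ M ⊕ (A ⊕ (B ⊕ C))) ↭.refl As [ m₀ ] Bs' Cs))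
        d≡ = sharedDegree Cs p in begin
      joinCount (0 ∷ m₀ ∷ []) (map (0 ,_) Bs' ++ E) * pronic (β + c)
    ≡⟨ cong (_* pronic (β + c)) (Σperm-↭ (rearrange m₀ Bs' p) _) ⟩
      joinCount (0 ∷ m₀ ∷ []) (C₀.pending As Bs' (m₀ ∷ []) Cs) * pronic (β + c)
    ≡⟨ cong (λ e → joinCount (0 ∷ m₀ ∷ []) (C₀.pending As Bs' (m₀ ∷ []) Cs) * pronic e) (sym d≡) ⟩
      joinCount (0 ∷ m₀ ∷ []) (C₀.pending As Bs' (m₀ ∷ []) Cs) * pronic (C₀.degree Bs' (m₀ ∷ []) Cs)
    ≡⟨ C₀.joinFraction n _ As Bs' (m₀ ∷ []) Cs (C₀.afterFirst z≤n (s≤s z≤n) (λ ()) refl (refl ∷ []) u l)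
         (suc-injective (trans (size-shuffle a (length Bs') c) (trans (cong (λ e → a + (e + (e + c))) (sym (↭-length p))) len))) ⟩
      n ! * (1 * suc (C₀.degree Bs' (m₀ ∷ []) Cs) + length Bs')
    ≡⟨ cong₂ (λ e f → n ! * (e + f)) (trans (cong (λ e → 1 * suc e) d≡) (*-identityˡ _)) (cong pred (sym (↭-length p))) ⟩
      n ! * (suc (β + c) + pred β)
    ∎)
    where
    rearrange : ∀ m₀ Bs' → Bs ↭ m₀ ∷ Bs' → map (0 ,_) Bs' ++ E ↭ C₀.pending As Bs' (m₀ ∷ []) Cs
    rearrange m₀ Bs' p = ↭.trans (++⁺ˡ (map (0 ,_) Bs') (↭.trans E↭ (++⁺ˡ XA (++⁺ʳ XC (map⁺ (1 ,_) p)))))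
      (solve 5 (λ P A Y Q C → P ⊕ (A ⊕ ((Y ⊕ Q) ⊕ C)) ⊜ A ⊕ (P ⊕ (Q ⊕ (Y ⊕ C)))) ↭.refl
        (map (0 ,_) Bs') XA [ (1 , m₀) ] (map (1 ,_) Bs') XC)
    size-shuffle : ∀ a b c → suc (a + (b + (b + (1 + c)))) ≡ a + (suc b + (suc b + c))
    size-shuffle = solve-∀

  fromB₁ : ∀ E → E ↭ XC ++ (XB₀ ++ XA) → Σfirst w XB₁ E * pronic (β + a) ≡ β * (n ! * (suc (β + a) + pred β))
  fromB₁ E E↭ = Σfirst-uniform w (1 ,_) Bs E (λ m₀ Bs' p →
    let (u , l) = leavesAfter (↭.trans (++⁺ˡ As (++⁺ʳ Cs p))
                    (solve 4 (λ A M B C → A ⊕ ((M ⊕ B) ⊕ C) ⊜ M ⊕ (C ⊕ (B ⊕ A))) ↭.refl As [ m₀ ] Bs' Cs))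
        d≡ = sharedDegree As p in begin
      joinCount (1 ∷ m₀ ∷ []) (map (1 ,_) Bs' ++ E) * pronic (β + a)
    ≡⟨ cong (_* pronic (β + a)) (Σperm-↭ (rearrange m₀ Bs' p) _) ⟩
      joinCount (1 ∷ m₀ ∷ []) (C₁.pending Cs Bs' (m₀ ∷ []) As) * pronic (β + a)
    ≡⟨ cong (λ e → joinCount (1 ∷ m₀ ∷ []) (C₁.pending Cs Bs' (m₀ ∷ []) As) * pronic e) (sym d≡) ⟩
      joinCount (1 ∷ m₀ ∷ []) (C₁.pending Cs Bs' (m₀ ∷ []) As) * pronic (C₁.degree Bs' (m₀ ∷ []) As)
    ≡⟨ C₁.joinFraction n _ Cs Bs' (m₀ ∷ []) As (C₁.afterFirst (s≤s z≤n) z≤n (λ ()) refl (refl ∷ []) u l)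
         (suc-injective (trans (size-shuffle c (length Bs') a) (trans (cong (λ e → a + (e + (e + c))) (sym (↭-length p))) len))) ⟩
      n ! * (1 * suc (C₁.degree Bs' (m₀ ∷ []) As) + length Bs')
    ≡⟨ cong₂ (λ e f → n ! * (e + f)) (trans (cong (λ e → 1 * suc e) d≡) (*-identityˡ _)) (cong pred (sym (↭-length p))) ⟩
      n ! * (suc (β + a) + pred β)
    ∎)
    where
    rearrange : ∀ m₀ Bs' → Bs ↭ m₀ ∷ Bs' → map (1 ,_) Bs' ++ E ↭ C₁.pending Cs Bs' (m₀ ∷ []) As
    rearrange m₀ Bs' p = ↭.trans (++⁺ˡ (map (1 ,_) Bs') (↭.trans E↭ (++⁺ˡ XC (++⁺ʳ XA (map⁺ (0 ,_) p)))))
      (solve 5 (λ P C Y Q A → P ⊕ (C ⊕ ((Y ⊕ Q) ⊕ A)) ⊜ C ⊕ (P ⊕ (Q ⊕ (Y ⊕ A)))) ↭.refl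
        (map (1 ,_) Bs') XC [ (0 , m₀) ] (map (0 ,_) Bs') XA)
    size-shuffle : ∀ c b a → suc (c + (b + (b + (1 + a)))) ≡ a + (suc b + (suc b + c))
    size-shuffle = solve-∀

  starEdges≢[] : starEdges As Bs Cs ≢ []
  starEdges≢[] e with trans (sym (cong length e)) (trans (C₀.length-pending As Bs [] Cs) len)
  ... | ()

  joinCount-star : joinCount [] (starEdges As Bs Cs) * (pronic (β + c) * pronic (β + a))
    ≡ suc n ! * (β * (pronic (β + c) + pronic (β + a)))
  joinCount-star = begin
      joinCount [] (starEdges As Bs Cs) * (P₀ * P₁)
    ≡⟨ cong (_* (P₀ * P₁)) split ⟩
      (sA + (sB₀ + (sB₁ + sC))) * (P₀ * P₁)
    ≡⟨ distribute sA sB₀ sB₁ sC P₀ P₁ ⟩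
      (sA * P₀) * P₁ + ((sB₀ * P₀) * P₁ + ((sB₁ * P₁) * P₀ + (sC * P₁) * P₀))
    ≡⟨ cong₂ _+_ (cong (_* P₁) (fromA _ (perm₁ XB₀ XB₁ XC)))
         (cong₂ _+_ (cong (_* P₁) (fromB₀ _ (perm₂ XA XB₁ XC)))
           (cong₂ _+_ (cong (_* P₀) (fromB₁ _ (perm₃ XA XB₀ XC)))
             (cong (_* P₀) (fromC _ (perm₄ XA XB₀ XB₁))))) ⟩
      (a * (n ! * β)) * P₁ + ((β * (n ! * (suc (β + c) + pred β))) * P₁
        + ((β * (n ! * (suc (β + a) + pred β))) * P₀ + (c * (n ! * β)) * P₀))
    ≡⟨ start-arithmetic a β c (n !) ⟩
      (a + (β + (β + c))) * n ! * (β * (P₀ + P₁))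
    ≡⟨ cong (λ e → e * n ! * (β * (P₀ + P₁))) len ⟩
      suc n ! * (β * (P₀ + P₁))
    ∎
    where
    P₀ = pronic (β + c)
    P₁ = pronic (β + a)
    sA = Σfirst w XA ((XB₀ ++ (XB₁ ++ XC)) ++ [])
    sB₀ = Σfirst w XB₀ ((XB₁ ++ XC) ++ (XA ++ []))
    sB₁ = Σfirst w XB₁ (XC ++ (XB₀ ++ (XA ++ [])))
    sC = Σfirst w XC (XB₁ ++ (XB₀ ++ (XA ++ [])))
    split : joinCount [] (starEdges As Bs Cs) ≡ sA + (sB₀ + (sB₁ + sC))
    split =
      trans (Σperm-by-first w (starEdges As Bs Cs) starEdges≢[])
      (trans (Σfirst-++ w XA (XB₀ ++ (XB₁ ++ XC)) [])
      (cong (sA +_)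
        (trans (Σfirst-++ w XB₀ (XB₁ ++ XC) (XA ++ []))
        (cong (sB₀ +_) (Σfirst-++ w XB₁ XC (XB₀ ++ (XA ++ [])))))))
    distribute : ∀ p q r s P₀ P₁ → (p + (q + (r + s))) * (P₀ * P₁) ≡ (p * P₀) * P₁ + ((q * P₀) * P₁ + ((r * P₁) * P₀ + (s * P₁) * P₀))
    distribute = solve-∀
    perm₁ : ∀ B₀ B₁ C → (B₀ ++ (B₁ ++ C)) ++ [] ↭ B₀ ++ (B₁ ++ C)
    perm₁ = solve 3 (λ B₀ B₁ C → (B₀ ⊕ (B₁ ⊕ C)) ⊕ id ⊜ B₀ ⊕ (B₁ ⊕ C)) ↭.refl
    perm₂ : ∀ A B₁ C → (B₁ ++ C) ++ (A ++ []) ↭ A ++ (B₁ ++ C)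
    perm₂ = solve 3 (λ A B₁ C → (B₁ ⊕ C) ⊕ (A ⊕ id) ⊜ A ⊕ (B₁ ⊕ C)) ↭.refl
    perm₃ : ∀ A B₀ C → C ++ (B₀ ++ (A ++ [])) ↭ C ++ (B₀ ++ A)
    perm₃ = solve 3 (λ A B₀ C → C ⊕ (B₀ ⊕ (A ⊕ id)) ⊜ C ⊕ (B₀ ⊕ A)) ↭.refl
    perm₄ : ∀ A B₀ B₁ → B₁ ++ (B₀ ++ (A ++ [])) ↭ B₁ ++ (B₀ ++ A)
    perm₄ = solve 3 (λ A B₀ B₁ → B₁ ⊕ (B₀ ⊕ (A ⊕ id)) ⊜ B₁ ⊕ (B₀ ⊕ A)) ↭.refl

-- The forest built from a star: it is a single tree exactly when some shared
-- leaf keeps both of its edges.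

Joined : List Edge → Set
Joined F = Σ ℕ λ z → ((0 , z) ∈ F) × ((1 , z) ∈ F)

StarShaped : List Edge → Set
StarShaped es = ∀ {x y} → (x , y) ∈ es → (x ≤ 1) × (2 ≤ y)

keeps : List ℕ → ℕ → ℕ → Bool
keeps S x y = not (x ∈ᵇ S) ∨ not (y ∈ᵇ S)

∈-if⁻ : ∀ b {e E : Edge} {L} → e ∈ (if b then E ∷ L else L) → e ≡ E ⊎ e ∈ L
∈-if⁻ true (here e≡E) = inj₁ e≡E
∈-if⁻ true (there e∈L) = inj₂ e∈L
∈-if⁻ false e∈L = inj₂ e∈L

∈-if⁺ : ∀ b {e E : Edge} {L} → e ∈ L → e ∈ (if b then E ∷ L else L)
∈-if⁺ true e∈L = there e∈L
∈-if⁺ false e∈L = e∈L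

buildFrom-⊆ : ∀ S es {e} → e ∈ buildFrom S es → e ∈ es
buildFrom-⊆ S ((x , y) ∷ es) e∈ with ∈-if⁻ (keeps S x y) e∈
... | inj₁ e≡ = here e≡
... | inj₂ e∈' = there (buildFrom-⊆ (x ∷ y ∷ S) es e∈')

buildFrom-covers : ∀ S es v {x} → v ∈ᵇ S ≡ false → (x , v) ∈ es → (∀ {x' y'} → (x' , y') ∈ es → x' ≢ v) →
  Σ ℕ λ x' → (x' , v) ∈ buildFrom S es
buildFrom-covers S ((x₀ , y₀) ∷ es) v v∉S e∈ notFrom with y₀ ≟ v
... | yes refl = x₀ , kept
  where
  kept : (x₀ , v) ∈ buildFrom S ((x₀ , v) ∷ es)
  kept rewrite v∉S | ∨-zeroʳ (not (x₀ ∈ᵇ S)) = here refl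
... | no y₀≢v with e∈
...   | here refl = ⊥-elim (y₀≢v refl)
...   | there e∈' =
  let (x' , k) = buildFrom-covers (x₀ ∷ y₀ ∷ S) es v (∈ᵇ-fresh x₀ y₀ S v (notFrom (here refl)) y₀≢v v∉S) e∈'
                   (λ m → notFrom (there m))
  in x' , ∈-if⁺ (keeps S x₀ y₀) k

-- Invariant of the process, where P lists the edges kept so far and S the
-- vertices seen so far (endpoints of all processed edges).
record Progress (S : List ℕ) (P : List Edge) : Set where
  field
    kept-centre : ∀ {x y} → (x , y) ∈ P → x ≤ 1
    kept-centre-seen : ∀ {x y} → (x , y) ∈ P → x ∈ᵇ S ≡ true
    kept-leaf-seen : ∀ {x y} → (x , y) ∈ P → y ∈ᵇ S ≡ true
    not-joined : ¬ Joined P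
    seen-leaf-kept : ∀ y → y ∈ᵇ S ≡ true → 2 ≤ y → Σ ℕ λ x → (x , y) ∈ P

seenLeaf⁻ : ∀ {x y S y'} → x ≤ 1 → y' ∈ᵇ (x ∷ y ∷ S) ≡ true → 2 ≤ y' → y ≡ y' ⊎ y' ∈ᵇ S ≡ true
seenLeaf⁻ {x} {y} {S} {y'} x≤1 seen 2≤y' with ∈ᵇ-∷⁻ x (y ∷ S) y' seen
... | inj₁ x≡y' = ⊥-elim (centre≢leaf x≤1 2≤y' x≡y')
... | inj₂ seen' = ∈ᵇ-∷⁻ y S y' seen'

∈-snoc⁻ : ∀ {P : List Edge} {e E} → e ∈ P ++ [ E ] → e ∈ P ⊎ e ≡ E
∈-snoc⁻ {P} e∈ with ∈-++⁻ P e∈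
... | inj₁ e∈P = inj₁ e∈P
... | inj₂ (here e≡E) = inj₂ e≡E

Progress-skip : ∀ {S P x y} → x ≤ 1 → y ∈ᵇ S ≡ true → Progress S P → Progress (x ∷ y ∷ S) P
Progress-skip {S} {P} {x} {y} x≤1 y∈S pr = record
  { kept-centre = kept-centre
  ; kept-centre-seen = λ {a} {b} e∈ → ∈ᵇ-keep x y S a (kept-centre-seen e∈)
  ; kept-leaf-seen = λ {a} {b} e∈ → ∈ᵇ-keep x y S b (kept-leaf-seen e∈)
  ; not-joined = not-joined
  ; seen-leaf-kept = λ y' seen 2≤y' → case seenLeaf⁻ {x} {y} {S} x≤1 seen 2≤y' of λ where
      (inj₁ refl) → seen-leaf-kept y y∈S 2≤y'
      (inj₂ seen') → seen-leaf-kept y' seen' 2≤y'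
  }
  where
  open Progress pr
  open import Function using (case_of_)

Progress-keep : ∀ {S P x y} → x ≤ 1 → 2 ≤ y → y ∈ᵇ S ≡ false → Progress S P → Progress (x ∷ y ∷ S) (P ++ [ (x , y) ])
Progress-keep {S} {P} {x} {y} x≤1 2≤y y∉S pr = record
  { kept-centre = λ e∈ → centre (∈-snoc⁻ {P} e∈)
  ; kept-centre-seen = λ e∈ → centreSeen (∈-snoc⁻ {P} e∈)
  ; kept-leaf-seen = λ e∈ → leafSeen (∈-snoc⁻ {P} e∈)
  ; not-joined = λ { (z , e₀ , e₁) → joined (∈-snoc⁻ {P} e₀) (∈-snoc⁻ {P} e₁) }
  ; seen-leaf-kept = λ y' seen 2≤y' → leafKept y' (seenLeaf⁻ {x} {y} {S} x≤1 seen 2≤y') 2≤y'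
  }
  where
  open Progress pr
  centre : ∀ {a b} → (a , b) ∈ P ⊎ (a , b) ≡ (x , y) → a ≤ 1
  centre (inj₁ e∈) = kept-centre e∈
  centre (inj₂ refl) = x≤1
  centreSeen : ∀ {a b} → (a , b) ∈ P ⊎ (a , b) ≡ (x , y) → a ∈ᵇ (x ∷ y ∷ S) ≡ true
  centreSeen {a} (inj₁ e∈) = ∈ᵇ-keep x y S a (kept-centre-seen e∈)
  centreSeen (inj₂ refl) = ∈ᵇ-head x (y ∷ S)
  leafSeen : ∀ {a b} → (a , b) ∈ P ⊎ (a , b) ≡ (x , y) → b ∈ᵇ (x ∷ y ∷ S) ≡ true
  leafSeen {a} {b} (inj₁ e∈) = ∈ᵇ-keep x y S b (kept-leaf-seen e∈)
  leafSeen (inj₂ refl) = ∈ᵇ-second x y S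
  -- the new leaf y was unseen, so P has no edge at y
  joined : ∀ {z} → (0 , z) ∈ P ⊎ (0 , z) ≡ (x , y) → (1 , z) ∈ P ⊎ (1 , z) ≡ (x , y) → ⊥
  joined {z} (inj₁ e₀) (inj₁ e₁) = not-joined (z , e₀ , e₁)
  joined (inj₁ e₀) (inj₂ refl) = true≢false (kept-leaf-seen e₀) y∉S
  joined (inj₂ refl) (inj₁ e₁) = true≢false (kept-leaf-seen e₁) y∉S
  joined (inj₂ refl) (inj₂ ())
  leafKept : ∀ y' → y ≡ y' ⊎ y' ∈ᵇ S ≡ true → 2 ≤ y' → Σ ℕ λ x' → (x' , y') ∈ P ++ [ (x , y) ]
  leafKept y' (inj₁ refl) _ = x , ∈-++⁺ʳ P (here refl)
  leafKept y' (inj₂ seen) 2≤y' = let (x' , e∈) = seen-leaf-kept y' seen 2≤y' in x' , ∈-++⁺ˡ e∈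

kept-leaf-unseen : ∀ {x y S} → x ∈ᵇ S ≡ true → keeps S x y ≡ true → y ∈ᵇ S ≡ false
kept-leaf-unseen {x} {y} {S} x∈S k rewrite x∈S with y ∈ᵇ S
... | false = refl

centre-seen : ∀ {x S} → x ≤ 1 → 0 ∈ᵇ S ≡ true → 1 ∈ᵇ S ≡ true → x ∈ᵇ S ≡ true
centre-seen z≤n 0∈S 1∈S = 0∈S
centre-seen (s≤s z≤n) 0∈S 1∈S = 1∈S

-- Once both centres are seen, every kept edge has a leaf that was unseen, so
-- no shared leaf keeps both of its edges any more.
bothSeen : ∀ S es → 0 ∈ᵇ S ≡ true → 1 ∈ᵇ S ≡ true → StarShaped es →
  (∀ {x y} → (x , y) ∈ buildFrom S es → y ∈ᵇ S ≡ false) × ¬ Joined (buildFrom S es)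
bothSeen S [] _ _ _ = (λ ()) , λ { (_ , () , _) }
bothSeen S ((x , y) ∷ es) 0∈S 1∈S star = step (keeps S x y) refl
  where
  S' = x ∷ y ∷ S
  T' = buildFrom S' es
  IH = bothSeen S' es (∈ᵇ-keep x y S 0 0∈S) (∈ᵇ-keep x y S 1 1∈S) (λ e∈ → star (there e∈))
  later-unseen : ∀ {x' y'} → (x' , y') ∈ T' → y' ∈ᵇ S ≡ false
  later-unseen {x'} {y'} e∈ = ∈ᵇ-shrink x y S y' (proj₁ IH e∈)
  step : ∀ b → b ≡ keeps S x y →
    (∀ {x' y'} → (x' , y') ∈ (if b then (x , y) ∷ T' else T') → y' ∈ᵇ S ≡ false) × ¬ Joined (if b then (x , y) ∷ T' else T')
  step false _ = later-unseen , proj₂ IH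
  step true k = unseen , notJoined
    where
    y∉S : y ∈ᵇ S ≡ false
    y∉S = kept-leaf-unseen {x} {y} {S} (centre-seen {S = S} (proj₁ (star (here refl))) 0∈S 1∈S) (sym k)
    unseen : ∀ {x' y'} → (x' , y') ∈ (x , y) ∷ T' → y' ∈ᵇ S ≡ false
    unseen (here refl) = y∉S
    unseen (there e∈) = later-unseen e∈
    -- y is seen from then on, so no later kept edge ends at y
    notJoined : ¬ Joined ((x , y) ∷ T')
    notJoined (z , here refl , here ())
    notJoined (z , here refl , there e₁) = true≢false (∈ᵇ-second x y S) (proj₁ IH e₁)
    notJoined (z , there e₀ , here refl) = true≢false (∈ᵇ-second x y S) (proj₁ IH e₀)
    notJoined (z , there e₀ , there e₁) = proj₂ IH (z , e₀ , e₁)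

noJoin-across : ∀ {P T' : List Edge} {S S' : List ℕ} {x y} →
  (∀ {a b} → (a , b) ∈ P → b ∈ᵇ S ≡ true) → ¬ Joined P → y ∈ᵇ S ≡ false →
  (∀ z → z ∈ᵇ S ≡ true → z ∈ᵇ S' ≡ true) → y ∈ᵇ S' ≡ true →
  (∀ {a b} → (a , b) ∈ T' → b ∈ᵇ S' ≡ false) → ¬ Joined T' → ¬ Joined (P ++ ((x , y) ∷ T'))
noJoin-across {P} {T'} {S} {S'} {x} {y} P-seen P-not y∉S grow y∈S' T'-unseen T'-not (z , e₀ , e₁) =
  cases (∈-++⁻ P e₀) (∈-++⁻ P e₁)
  where
  cases : (0 , z) ∈ P ⊎ (0 , z) ∈ (x , y) ∷ T' → (1 , z) ∈ P ⊎ (1 , z) ∈ (x , y) ∷ T' → ⊥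
  cases (inj₁ f₀) (inj₁ f₁) = P-not (z , f₀ , f₁)
  cases (inj₁ f₀) (inj₂ (here refl)) = true≢false (P-seen f₀) y∉S
  cases (inj₁ f₀) (inj₂ (there f₁)) = true≢false (grow z (P-seen f₀)) (T'-unseen f₁)
  cases (inj₂ (here refl)) (inj₁ f₁) = true≢false (P-seen f₁) y∉S
  cases (inj₂ (here refl)) (inj₂ (here ()))
  cases (inj₂ (here refl)) (inj₂ (there f₁)) = true≢false y∈S' (T'-unseen f₁)
  cases (inj₂ (there f₀)) (inj₁ f₁) = true≢false (grow z (P-seen f₁)) (T'-unseen f₀)
  cases (inj₂ (there f₀)) (inj₂ (here refl)) = true≢false y∈S' (T'-unseen f₀)
  cases (inj₂ (there f₀)) (inj₂ (there f₁)) = T'-not (z , f₀ , f₁)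

joined-by : ∀ {P L : List Edge} {x x' y} → x ≤ 1 → x' ≤ 1 → x ≢ x' → (x , y) ∈ L → (x' , y) ∈ P → Joined (P ++ L)
joined-by {P} {L} {x} {x'} {y} x≤1 x'≤1 x≢x' e∈L e∈P with centre-cases x≤1 | centre-cases x'≤1
... | inj₁ refl | inj₁ refl = ⊥-elim (x≢x' refl)
... | inj₁ refl | inj₂ refl = y , ∈-++⁺ʳ P e∈L , ∈-++⁺ˡ e∈P
... | inj₂ refl | inj₁ refl = y , ∈-++⁺ˡ e∈P , ∈-++⁺ʳ P e∈L
... | inj₂ refl | inj₂ refl = ⊥-elim (x≢x' refl)

centres-seen : ∀ {x y S} → x ≤ 1 → other x ∈ᵇ S ≡ true → (0 ∈ᵇ (x ∷ y ∷ S) ≡ true) × (1 ∈ᵇ (x ∷ y ∷ S) ≡ true)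
centres-seen {.0} {y} {S} z≤n o∈S = ∈ᵇ-head 0 (y ∷ S) , ∈ᵇ-keep 0 y S 1 o∈S
centres-seen {.1} {y} {S} (s≤s z≤n) o∈S = ∈ᵇ-keep 1 y S 0 o∈S , ∈ᵇ-head 1 (y ∷ S)

joins-correct : ∀ es S P → StarShaped es → Progress S P → (joins S es ≡ true) ⇔ Joined (P ++ buildFrom S es)
joins-correct [] S P _ pr = mk⇔ (λ ()) (λ j → ⊥-elim (Progress.not-joined pr (subst Joined (++-identityʳ P) j)))
joins-correct ((x , y) ∷ es) S P star pr = step (x ∈ᵇ S) (y ∈ᵇ S) (other x ∈ᵇ S) refl refl refl
  where
  open Progress pr
  x≤1 : x ≤ 1
  x≤1 = proj₁ (star (here refl))
  S' = x ∷ y ∷ S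
  T' = buildFrom S' es
  star' : StarShaped es
  star' e∈ = star (there e∈)
  keepStep : y ∈ᵇ S ≡ false → (joins S' es ≡ true) ⇔ Joined (P ++ ((x , y) ∷ T'))
  keepStep y∉S = subst (λ L → (joins S' es ≡ true) ⇔ Joined L) (++-assoc P [ (x , y) ] T')
    (joins-correct es S' (P ++ [ (x , y) ]) star' (Progress-keep x≤1 (proj₂ (star (here refl))) y∉S pr))
  step : ∀ bx by bo → x ∈ᵇ S ≡ bx → y ∈ᵇ S ≡ by → other x ∈ᵇ S ≡ bo →
    ((if bx then joins S' es else (if by then true else (if bo then false else joins S' es))) ≡ true)
      ⇔ Joined (P ++ (if (not bx ∨ not by) then (x , y) ∷ T' else T'))
  step true true _ _ y∈S _ = joins-correct es S' P star' (Progress-skip x≤1 y∈S pr)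
  step true false _ _ y∉S _ = keepStep y∉S
  step false false false _ y∉S _ = keepStep y∉S
  -- the seen leaf y already has a kept edge, from a seen centre x' ≠ x
  step false true _ x∉S y∈S _ = mk⇔ (λ _ → joined-by x≤1 (kept-centre e∈) x≢x' (here refl) e∈) (λ _ → refl)
    where
    x' = proj₁ (seen-leaf-kept y y∈S (proj₂ (star (here refl))))
    e∈ = proj₂ (seen-leaf-kept y y∈S (proj₂ (star (here refl))))
    x≢x' : x ≢ x'
    x≢x' x≡x' = true≢false (trans (cong (_∈ᵇ S) x≡x') (kept-centre-seen e∈)) x∉S
  -- both centres are now seen, so nothing joins them any more
  step false false true _ y∉S o∈S = mk⇔ (λ ()) (λ j → ⊥-elim (noJoin-across {P} {T'} {S} {S'} {x} {y}
      kept-leaf-seen not-joined y∉S (λ z → ∈ᵇ-keep x y S z) (∈ᵇ-second x y S) (proj₁ later) (proj₂ later) j))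
    where
    seen = centres-seen {x} {y} {S} x≤1 o∈S
    later = bothSeen S' es (proj₁ seen) (proj₂ seen) star'

joins⇔Joined : ∀ σ → StarShaped σ → (joins [] σ ≡ true) ⇔ Joined (buildForest σ)
joins⇔Joined σ star = joins-correct σ [] [] star record
  { kept-centre = λ ()
  ; kept-centre-seen = λ ()
  ; kept-leaf-seen = λ ()
  ; not-joined = λ { (_ , () , _) }
  ; seen-leaf-kept = λ _ ()
  }

module _ {A : Set} (p : A → Bool) where

  any-intro : ∀ {x xs} → x ∈ xs → p x ≡ true → any p xs ≡ true
  any-intro {xs = y ∷ _} (here refl) px rewrite px = refl
  any-intro {xs = y ∷ _} (there x∈) px = ∨-trueʳ (p y) (any-intro x∈ px)

  any-elim : ∀ xs → any p xs ≡ true → Σ A λ x → (x ∈ xs) × (p x ≡ true)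
  any-elim (y ∷ xs) e with ∨-split (p y) e
  ... | inj₁ py = y , here refl , py
  ... | inj₂ rest = let (x , x∈ , px) = any-elim xs rest in x , there x∈ , px

  all-intro : ∀ xs → (∀ {x} → x ∈ xs → p x ≡ true) → all p xs ≡ true
  all-intro [] h = refl
  all-intro (y ∷ xs) h rewrite h (here refl) = all-intro xs (λ x∈ → h (there x∈))

  all-false : ∀ {x xs} → x ∈ xs → p x ≡ false → all p xs ≡ false
  all-false {xs = y ∷ _} (here refl) px rewrite px = refl
  all-false {xs = y ∷ _} (there x∈) px rewrite all-false x∈ px = ∧-zeroʳ (p y)

  length-filter : ∀ xs → length (filter (λ v → T? (p v)) xs) ≡ sumBy (λ v → 𝟙 (p v)) xs
  length-filter [] = refl
  length-filter (x ∷ xs) with p x in px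
  ... | true = cong suc (length-filter xs)
  ... | false = length-filter xs

adj-intro : ∀ F a b → (a , b) ∈ F → (adj F a b ≡ true) × (adj F b a ≡ true)
adj-intro F a b e∈ = any-intro _ e∈ (cong (_∨ ((a ≡ᵇ b) ∧ (b ≡ᵇ a))) both) , any-intro _ e∈ (∨-trueʳ _ both)
  where
  both : ((a ≡ᵇ a) ∧ (b ≡ᵇ b)) ≡ true
  both rewrite ≡ᵇ-refl a | ≡ᵇ-refl b = refl

adj-elim : ∀ F z y → adj F z y ≡ true → Σ Edge λ e → (e ∈ F) × (e ≡ (z , y) ⊎ e ≡ (y , z))
adj-elim F z y e with any-elim _ F e
... | (a , b) , e∈ , match with ∨-split ((a ≡ᵇ z) ∧ (b ≡ᵇ y)) match
...   | inj₁ m = let (a≡ , b≡) = ∧-split (a ≡ᵇ z) m in (a , b) , e∈ , inj₁ (cong₂ _,_ (≡ᵇ-true a≡) (≡ᵇ-true b≡))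
...   | inj₂ m = let (a≡ , b≡) = ∧-split (a ≡ᵇ y) m in (a , b) , e∈ , inj₂ (cong₂ _,_ (≡ᵇ-true a≡) (≡ᵇ-true b≡))

reach-refl : ∀ V F i v → reachWithin V F i v v ≡ true
reach-refl V F zero v = ≡ᵇ-refl v
reach-refl V F (suc i) v rewrite reach-refl V F i v = refl

reach-step : ∀ V F i x z y → z ∈ V → reachWithin V F i x z ≡ true → adj F z y ≡ true → reachWithin V F (suc i) x y ≡ true
reach-step V F i x z y z∈V r a = ∨-trueʳ (reachWithin V F i x y)
  (any-intro (λ u → reachWithin V F i x u ∧ adj F u y) z∈V (subst (λ q → (q ∧ adj F z y) ≡ true) (sym r) a))

module Components (rest : List ℕ) (F : List Edge) (star : StarShaped F)
  (F⊆rest : ∀ {x y} → (x , y) ∈ F → y ∈ rest)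
  (covers : ∀ {v} → v ∈ rest → Σ ℕ λ x → (x , v) ∈ F)
  (leaves : ∀ {v} → v ∈ rest → 2 ≤ v) where

  V : List ℕ
  V = 0 ∷ 1 ∷ rest

  joined⇒connected : Joined F → connected V F 1 0 ≡ true
  joined⇒connected (z , e₀ , e₁) = reach-step V F (suc (length rest)) 1 z 0 (there (there (F⊆rest e₀)))
    (reach-step V F (length rest) 1 1 z (there (here refl)) (reach-refl V F (length rest) 1) (proj₁ (adj-intro F 1 z e₁)))
    (proj₂ (adj-intro F 0 z e₀))

  reach-from-1 : ¬ Joined F → ∀ i y → reachWithin V F i 1 y ≡ true → y ≡ 1 ⊎ (1 , y) ∈ F
  reach-from-1 notJ zero y e = inj₁ (sym (≡ᵇ-true e))
  reach-from-1 notJ (suc i) y e with ∨-split (reachWithin V F i 1 y) e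
  ... | inj₁ e' = reach-from-1 notJ i y e'
  ... | inj₂ e' with any-elim (λ u → reachWithin V F i 1 u ∧ adj F u y) V e'
  ...   | z , _ , step with ∧-split (reachWithin V F i 1 z) step
  ...     | r , a with reach-from-1 notJ i z r | adj-elim F z y a
  ...       | inj₁ refl | (.1 , .y) , e∈ , inj₁ refl = inj₂ e∈
  ...       | inj₁ refl | (.y , .1) , e∈ , inj₂ refl = ⊥-elim (centre≢leaf (s≤s z≤n) (proj₂ (star e∈)) refl)
  ...       | inj₂ f∈ | (.z , .y) , e∈ , inj₁ refl = ⊥-elim (centre≢leaf (proj₁ (star e∈)) (proj₂ (star f∈)) refl)
  ...       | inj₂ f∈ | (.y , .z) , e∈ , inj₂ refl with centre-cases (proj₁ (star e∈))
  ...         | inj₁ refl = ⊥-elim (notJ (z , e∈ , f∈))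
  ...         | inj₂ refl = inj₁ refl

  unjoined⇒disconnected : ¬ Joined F → connected V F 1 0 ≡ false
  unjoined⇒disconnected notJ with connected V F 1 0 in e
  ... | false = refl
  ... | true with reach-from-1 notJ (length V) 0 e
  ...   | inj₂ e∈ = ⊥-elim (centre≢leaf z≤n (proj₂ (star e∈)) refl)

  isLeast : ℕ → Bool
  isLeast v = all (λ x → not (connected V F v x) ∨ (v ≤ᵇ x)) V

  isLeast-0 : isLeast 0 ≡ true
  isLeast-0 = all-intro _ V (λ {x} _ → ∨-trueʳ (not (connected V F 0 x)) refl)

  1≤ᵇleaf : ∀ {v} → 2 ≤ v → (1 ≤ᵇ v) ≡ true
  1≤ᵇleaf (s≤s (s≤s _)) = refl

  isLeast-1 : isLeast 1 ≡ not (connected V F 1 0)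
  isLeast-1 rewrite all-intro (λ x → not (connected V F 1 x) ∨ (1 ≤ᵇ x)) rest
                      (λ {x} x∈ → ∨-trueʳ (not (connected V F 1 x)) (1≤ᵇleaf (leaves x∈)))
                  | ∨-trueʳ (not (connected V F 1 1)) {1 ≤ᵇ 1} refl
    = trans (∧-identityʳ _) (∨-identityʳ _)

  -- a leaf is connected to the centre of its edge, which is smaller
  isLeast-leaf : ∀ {v} → v ∈ rest → isLeast v ≡ false
  isLeast-leaf {v} v∈ = all-false (λ y → not (connected V F v y) ∨ (v ≤ᵇ y)) x∈V
      (subst (λ q → (not q ∨ (v ≤ᵇ x)) ≡ false) (sym conn) (leaf≰ᵇcentre (leaves v∈) (proj₁ (star e∈))))
    where
    x = proj₁ (covers v∈)
    e∈ = proj₂ (covers v∈)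
    x∈V : x ∈ V
    x∈V = centre∈V (proj₁ (star e∈))
      where
      centre∈V : ∀ {x} → x ≤ 1 → x ∈ V
      centre∈V z≤n = here refl
      centre∈V (s≤s z≤n) = there (here refl)
    conn : connected V F v x ≡ true
    conn = reach-step V F (suc (length rest)) v v x (there (there v∈)) (reach-refl V F (suc (length rest)) v)
             (proj₂ (adj-intro F x v e∈))
    leaf≰ᵇcentre : ∀ {v x} → 2 ≤ v → x ≤ 1 → (v ≤ᵇ x) ≡ false
    leaf≰ᵇcentre (s≤s (s≤s _)) z≤n = refl
    leaf≰ᵇcentre (s≤s (s≤s _)) (s≤s z≤n) = refl

  numComponents-star : (r : Bool) → (r ≡ true) ⇔ Joined F → numComponents V F ≡ (if r then 1 else 2)
  numComponents-star r r⇔J = trans (length-filter isLeast V) (count r r⇔J)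
    where
    leaves-not-least : ∀ xs → (∀ {v} → v ∈ xs → v ∈ rest) → sumBy (λ v → 𝟙 (isLeast v)) xs ≡ 0
    leaves-not-least [] _ = refl
    leaves-not-least (x ∷ xs) h rewrite isLeast-leaf (h (here refl)) = leaves-not-least xs (λ m → h (there m))
    count : (r : Bool) → (r ≡ true) ⇔ Joined F → 𝟙 (isLeast 0) + (𝟙 (isLeast 1) + sumBy (λ v → 𝟙 (isLeast v)) rest) ≡ (if r then 1 else 2)
    count true r⇔J rewrite isLeast-0 | isLeast-1 | joined⇒connected (Equivalence.to r⇔J refl)
      | leaves-not-least rest (λ m → m) = refl
    count false r⇔J rewrite isLeast-0 | isLeast-1 | unjoined⇒disconnected (λ j → true≢false (Equivalence.from r⇔J j) refl)
      | leaves-not-least rest (λ m → m) = refl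

leavesA : ℕ → List ℕ
leavesA a = applyUpTo (2 +_) a

leavesB : ℕ → ℕ → List ℕ
leavesB a b = applyUpTo (λ j → 2 + a + j) b

leavesC : ℕ → ℕ → ℕ → List ℕ
leavesC a b c = applyUpTo (λ l → 2 + a + b + l) c

allLeaves : ℕ → ℕ → ℕ → List ℕ
allLeaves a b c = leavesA a ++ (leavesB a b ++ leavesC a b c)

applyUpTo-++ : ∀ {A : Set} (f : ℕ → A) m n → applyUpTo f (m + n) ≡ applyUpTo f m ++ applyUpTo (λ i → f (m + i)) n
applyUpTo-++ f zero n = refl
applyUpTo-++ f (suc m) n = cong (f 0 ∷_) (applyUpTo-++ (λ i → f (suc i)) m n)

leaves-GS : ∀ a b c → applyUpTo (2 +_) (a + b + c) ≡ allLeaves a b c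
leaves-GS a b c = begin
    applyUpTo (2 +_) (a + b + c)
  ≡⟨ applyUpTo-++ (2 +_) (a + b) c ⟩
    applyUpTo (2 +_) (a + b) ++ leavesC a b c
  ≡⟨ cong (_++ leavesC a b c) (applyUpTo-++ (2 +_) a b) ⟩
    (leavesA a ++ leavesB a b) ++ leavesC a b c
  ≡⟨ ++-assoc (leavesA a) (leavesB a b) (leavesC a b c) ⟩
    allLeaves a b c
  ∎
  where open ≡-Reasoning

verts-GS : ∀ a b c → verts (GS a b c) ≡ 0 ∷ 1 ∷ allLeaves a b c
verts-GS a b c = cong (λ L → 0 ∷ 1 ∷ L) (leaves-GS a b c)

allLeaves-unique : ∀ a b c → Unique (allLeaves a b c)
allLeaves-unique a b c = subst Unique (leaves-GS a b c)
  (applyUpTo⁺₁ (2 +_) (a + b + c) (λ i<j _ e → <⇒≢ i<j (suc-injective (suc-injective e))))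

allLeaves-≥2 : ∀ a b c → All (2 ≤_) (allLeaves a b c)
allLeaves-≥2 a b c = subst (All (2 ≤_)) (leaves-GS a b c) (All.applyUpTo⁺₂ (2 +_) (a + b + c) (λ _ → s≤s (s≤s z≤n)))
  where import Data.List.Relation.Unary.All.Properties as All

concatMap-pairs-↭ : ∀ {A B : Set} (f g : A → B) xs → concatMap (λ x → f x ∷ g x ∷ []) xs ↭ map f xs ++ map g xs
concatMap-pairs-↭ f g [] = ↭.refl
concatMap-pairs-↭ f g (x ∷ xs) = prep (f x)
  (↭.trans (prep (g x) (concatMap-pairs-↭ f g xs)) (↭-sym (shift (g x) (map f xs) (map g xs))))

edges-GS : ∀ a b c → edges (GS a b c) ↭ starEdges (leavesA a) (leavesB a b) (leavesC a b c)
edges-GS a b c = ↭.trans (++⁺ (↭-reflexive (asMap (0 ,_) (2 +_) a))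
  (↭.trans (++⁺ʳ edgesC (concatMap-pairs-↭ (λ j → (0 , 2 + a + j)) (λ j → (1 , 2 + a + j)) (upTo b)))
    (↭-reflexive (trans (++-assoc (map (λ j → (0 , 2 + a + j)) (upTo b)) (map (λ j → (1 , 2 + a + j)) (upTo b)) edgesC)
      (cong₂ (λ X Y → X ++ (Y ++ edgesC)) (asMap (0 ,_) (λ j → 2 + a + j) b) (asMap (1 ,_) (λ j → 2 + a + j) b))))))
  (↭-reflexive (cong (λ X → map (0 ,_) (leavesA a) ++ (map (0 ,_) (leavesB a b) ++ (map (1 ,_) (leavesB a b) ++ X)))
                          (asMap (1 ,_) (λ l → 2 + a + b + l) c)))
  where
  edgesC : List Edge
  edgesC = map (λ l → (1 , 2 + a + b + l)) (upTo c)
  asMap : (e : ℕ → Edge) (f : ℕ → ℕ) (n : ℕ) → map (λ i → e (f i)) (upTo n) ≡ map e (applyUpTo f n)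
  asMap e f n = trans (map-upTo (λ i → e (f i)) n) (sym (map-applyUpTo f e n))

from : ∀ {x : ℕ} {Xs Ys : List ℕ} {e : Edge} → x ≤ 1 → (∀ {v} → v ∈ Xs → v ∈ Ys) → e ∈ map (x ,_) Xs → (proj₁ e ≤ 1) × (proj₂ e ∈ Ys)
from {x} x≤1 Xs⊆Ys e∈ with ∈-map⁻ (x ,_) e∈
... | v , v∈ , refl = x≤1 , Xs⊆Ys v∈

starEdges-⊆ : ∀ As Bs Cs {e} → e ∈ starEdges As Bs Cs → (proj₁ e ≤ 1) × (proj₂ e ∈ As ++ (Bs ++ Cs))
starEdges-⊆ As Bs Cs e∈ with ∈-++⁻ (map (0 ,_) As) e∈
... | inj₁ e∈A = from z≤n (∈-++⁺ˡ {ys = Bs ++ Cs}) e∈A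
... | inj₂ e∈' with ∈-++⁻ (map (0 ,_) Bs) e∈'
...   | inj₁ e∈B = from z≤n (λ v∈ → ∈-++⁺ʳ As (∈-++⁺ˡ {ys = Cs} v∈)) e∈B
...   | inj₂ e∈'' with ∈-++⁻ (map (1 ,_) Bs) e∈''
...     | inj₁ e∈B = from (s≤s z≤n) (λ v∈ → ∈-++⁺ʳ As (∈-++⁺ˡ {ys = Cs} v∈)) e∈B
...     | inj₂ e∈C = from (s≤s z≤n) (λ v∈ → ∈-++⁺ʳ As (∈-++⁺ʳ Bs v∈)) e∈C

starEdges-covers : ∀ As Bs Cs {v} → v ∈ As ++ (Bs ++ Cs) → Σ ℕ λ x → (x , v) ∈ starEdges As Bs Cs
starEdges-covers As Bs Cs v∈ with ∈-++⁻ As v∈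
... | inj₁ v∈A = 0 , ∈-++⁺ˡ (∈-map⁺ (0 ,_) v∈A)
... | inj₂ v∈' with ∈-++⁻ Bs v∈'
...   | inj₁ v∈B = 0 , ∈-++⁺ʳ (map (0 ,_) As) (∈-++⁺ˡ (∈-map⁺ (0 ,_) v∈B))
...   | inj₂ v∈C = 1 , ∈-++⁺ʳ (map (0 ,_) As) (∈-++⁺ʳ (map (0 ,_) Bs) (∈-++⁺ʳ (map (1 ,_) Bs) (∈-map⁺ (1 ,_) v∈C)))

numTrees-GS : ∀ a b c σ → σ ∈ perms (edges (GS a b c)) → numTrees (GS a b c) σ ≡ (if joins [] σ then 1 else 2)
numTrees-GS a b c σ σ∈ = trans (cong (λ V → numComponents V F) (verts-GS a b c)) (
  Components.numComponents-star (allLeaves a b c) F (λ e∈ → star (buildFrom-⊆ [] σ e∈))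
    (λ e∈ → proj₂ (starEdges-⊆ As Bs Cs (toStar (buildFrom-⊆ [] σ e∈))))
    covers (All.lookup (allLeaves-≥2 a b c)) (joins [] σ) (joins⇔Joined σ star))
  where
  As = leavesA a
  Bs = leavesB a b
  Cs = leavesC a b c
  F = buildForest σ
  σ↭ : σ ↭ starEdges As Bs Cs
  σ↭ = ↭.trans (perms-↭ (edges (GS a b c)) σ∈) (edges-GS a b c)
  toStar : ∀ {e} → e ∈ σ → e ∈ starEdges As Bs Cs
  toStar = ∈-resp-↭ σ↭
  star : StarShaped σ
  star e∈ = let (x≤1 , v∈) = starEdges-⊆ As Bs Cs (toStar e∈) in x≤1 , All.lookup (allLeaves-≥2 a b c) v∈
  covers : ∀ {v} → v ∈ allLeaves a b c → Σ ℕ λ x → (x , v) ∈ F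
  covers {v} v∈ = let (x , e∈) = starEdges-covers As Bs Cs v∈ in
    buildFrom-covers [] σ v refl (∈-resp-↭ (↭-sym σ↭) e∈)
      (λ e∈' x'≡v → centre≢leaf (proj₁ (star e∈')) (All.lookup (allLeaves-≥2 a b c) v∈) x'≡v)

onOneTwo : ℕ → ℕ → ℕ → ℕ
onOneTwo (suc zero) x y = x
onOneTwo (suc (suc zero)) x y = y
onOneTwo _ x y = 0

onOneTwo-trees : ∀ k r → 𝟙 ((if r then 1 else 2) ≡ᵇ k) ≡ onOneTwo k (𝟙 r) (𝟙 (not r))
onOneTwo-trees zero r = onOneTwo-zero r
  where
  onOneTwo-zero : ∀ r → 𝟙 ((if r then 1 else 2) ≡ᵇ 0) ≡ 0
  onOneTwo-zero true = refl
  onOneTwo-zero false = refl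
onOneTwo-trees (suc zero) true = refl
onOneTwo-trees (suc zero) false = refl
onOneTwo-trees (suc (suc zero)) true = refl
onOneTwo-trees (suc (suc zero)) false = refl
onOneTwo-trees (suc (suc (suc k))) true = refl
onOneTwo-trees (suc (suc (suc k))) false = refl

Σperm-onOneTwo : ∀ {A : Set} k (f g : List A → ℕ) L → Σperm (λ σ → onOneTwo k (f σ) (g σ)) L ≡ onOneTwo k (Σperm f L) (Σperm g L)
Σperm-onOneTwo zero f g L = Σperm-zero L
Σperm-onOneTwo (suc zero) f g L = refl
Σperm-onOneTwo (suc (suc zero)) f g L = refl
Σperm-onOneTwo (suc (suc (suc k))) f g L = Σperm-zero L

starGS : ℕ → ℕ → ℕ → List Edge
starGS a b c = starEdges (leavesA a) (leavesB a b) (leavesC a b c)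

oneTree twoTrees : ℕ → ℕ → ℕ → ℕ
oneTree a b c = joinCount [] (starGS a b c)
twoTrees a b c = Σperm (λ σ → 𝟙 (not (joins [] σ))) (starGS a b c)

countOrderings-GS : ∀ a b c k → countOrderings (GS a b c) k ≡ onOneTwo k (oneTree a b c) (twoTrees a b c)
countOrderings-GS a b c k = begin
    countOrderings (GS a b c) k
  ≡⟨ length-filter (λ σ → numTrees (GS a b c) σ ≡ᵇ k) (perms (edges (GS a b c))) ⟩
    Σperm (λ σ → 𝟙 (numTrees (GS a b c) σ ≡ᵇ k)) (edges (GS a b c))
  ≡⟨ sumBy-congᴬ (All.tabulate (λ {σ} σ∈ → trans (cong (λ q → 𝟙 (q ≡ᵇ k)) (numTrees-GS a b c σ σ∈)) (onOneTwo-trees k (joins [] σ)))) ⟩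
    Σperm (λ σ → onOneTwo k (𝟙 (joins [] σ)) (𝟙 (not (joins [] σ)))) (edges (GS a b c))
  ≡⟨ Σperm-↭ (edges-GS a b c) _ ⟩
    Σperm (λ σ → onOneTwo k (𝟙 (joins [] σ)) (𝟙 (not (joins [] σ)))) (starGS a b c)
  ≡⟨ Σperm-onOneTwo k _ _ (starGS a b c) ⟩
    onOneTwo k (oneTree a b c) (twoTrees a b c)
  ∎
  where open ≡-Reasoning

oneTree+twoTrees : ∀ a b c → oneTree a b c + twoTrees a b c ≡ length (edges (GS a b c)) !
oneTree+twoTrees a b c = begin
    oneTree a b c + twoTrees a b c
  ≡⟨ sym (Σperm-+ (λ σ → 𝟙 (joins [] σ)) (λ σ → 𝟙 (not (joins [] σ))) (starGS a b c)) ⟩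
    Σperm (λ σ → 𝟙 (joins [] σ) + 𝟙 (not (joins [] σ))) (starGS a b c)
  ≡⟨ Σperm-cong (λ σ → 𝟙-complement (joins [] σ)) (starGS a b c) ⟩
    Σperm (λ _ → 1) (starGS a b c)
  ≡⟨ Σperm-count _ (starGS a b c) (sym (↭-length (edges-GS a b c))) ⟩
    length (edges (GS a b c)) !
  ∎
  where
  open ≡-Reasoning
  𝟙-complement : ∀ r → 𝟙 r + 𝟙 (not r) ≡ 1
  𝟙-complement true = refl
  𝟙-complement false = refl

oneTreeNum oneTreeDen : ℕ → ℕ → ℕ → ℕ
oneTreeNum a b c = b * (pronic (b + c) + pronic (b + a))
oneTreeDen a b c = pronic (b + c) * pronic (b + a)

oneTree-GS : ∀ a b c → 1 ≤ b → oneTree a b c * oneTreeDen a b c ≡ length (edges (GS a b c)) ! * oneTreeNum a b c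
oneTree-GS a (suc b) c _ = trans
  (at-lengths {T = oneTree a (suc b) c} {F = suc n !} (length-applyUpTo (2 +_) a) (length-applyUpTo (λ j → 2 + a + j) (suc b))
    (length-applyUpTo (λ l → 2 + a + suc b + l) c)
    (Start.joinCount-star As Bs Cs (allLeaves-unique a (suc b) c) (allLeaves-≥2 a (suc b) c) len))
  (cong (λ m → m ! * oneTreeNum a (suc b) c) edgeCount)
  where
  As = leavesA a
  Bs = leavesB a (suc b)
  Cs = leavesC a (suc b) c
  n = a + (b + (suc b + c))
  len : Counting.size 0 1 As Bs [] Cs ≡ suc n
  len = trans (cong₃ (λ x y z → x + (y + (y + z))) (length-applyUpTo (2 +_) a) (length-applyUpTo (λ j → 2 + a + j) (suc b))
                (length-applyUpTo (λ l → 2 + a + suc b + l) c))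
              (+-suc a (b + (suc b + c)))
    where
    cong₃ : ∀ (f : ℕ → ℕ → ℕ → ℕ) {x x' y y' z z'} → x ≡ x' → y ≡ y' → z ≡ z' → f x y z ≡ f x' y' z'
    cong₃ f refl refl refl = refl
  edgeCount : suc n ≡ length (edges (GS a (suc b) c))
  edgeCount = sym (trans (↭-length (edges-GS a (suc b) c)) (trans (Counting.length-pending 0 1 As Bs [] Cs) len))
  at-lengths : ∀ {T F a' β c'} → a' ≡ a → β ≡ suc b → c' ≡ c →
    T * (pronic (β + c') * pronic (β + a')) ≡ F * (β * (pronic (β + c') + pronic (β + a'))) →
    T * oneTreeDen a (suc b) c ≡ F * oneTreeNum a (suc b) c
  at-lengths refl refl refl e = e

quotient-cross : ∀ x y m n .{{_ : NonZero m}} .{{_ : NonZero n}} → x * n ≡ y * m → (ℤ.+ x) / m ≡ (ℤ.+ y) / n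
quotient-cross x y (suc p) (suc q) e =
  fromℚᵘ-cong {mkℚᵘ (ℤ.+ x) p} {mkℚᵘ (ℤ.+ y) q} (*≡* (trans (sym (pos-* x (suc q))) (trans (cong ℤ.+_ e) (pos-* y (suc p)))))

P-from-oneTree : ∀ (G₁ G₂ : Graph) T₁ T̄₁ T₂ T̄₂ → let F₁ = length (edges G₁) !; F₂ = length (edges G₂) ! in
  (∀ k → countOrderings G₁ k ≡ onOneTwo k T₁ T̄₁) → T₁ + T̄₁ ≡ F₁ →
  (∀ k → countOrderings G₂ k ≡ onOneTwo k T₂ T̄₂) → T₂ + T̄₂ ≡ F₂ →
  T₁ * F₂ ≡ T₂ * F₁ → ∀ k → P G₁ k ≡ P G₂ k
P-from-oneTree G₁ G₂ T₁ T̄₁ T₂ T̄₂ count₁ total₁ count₂ total₂ oneTree≡ k = begin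
    P G₁ k
  ≡⟨ cong (λ x → (ℤ.+ x) / F₁) (count₁ k) ⟩
    (ℤ.+ onOneTwo k T₁ T̄₁) / F₁
  ≡⟨ quotient-cross (onOneTwo k T₁ T̄₁) (onOneTwo k T₂ T̄₂) F₁ F₂ (cross k) ⟩
    (ℤ.+ onOneTwo k T₂ T̄₂) / F₂
  ≡⟨ cong (λ x → (ℤ.+ x) / F₂) (count₂ k) ⟨
    P G₂ k
  ∎
  where
  open ≡-Reasoning
  F₁ = length (edges G₁) !
  F₂ = length (edges G₂) !
  instance
    _ = length (edges G₁) !≢0
    _ = length (edges G₂) !≢0
  -- the complementary event: T̄ = F − T
  twoTrees≡ : T̄₁ * F₂ ≡ T̄₂ * F₁
  twoTrees≡ = +-cancelˡ-≡ (T₁ * F₂) (T̄₁ * F₂) (T̄₂ * F₁) (begin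
      T₁ * F₂ + T̄₁ * F₂
    ≡⟨ *-distribʳ-+ F₂ T₁ T̄₁ ⟨
      (T₁ + T̄₁) * F₂
    ≡⟨ cong (_* F₂) total₁ ⟩
      F₁ * F₂
    ≡⟨ *-comm F₁ F₂ ⟩
      F₂ * F₁
    ≡⟨ cong (_* F₁) total₂ ⟨
      (T₂ + T̄₂) * F₁
    ≡⟨ *-distribʳ-+ F₁ T₂ T̄₂ ⟩
      T₂ * F₁ + T̄₂ * F₁
    ≡⟨ cong (_+ T̄₂ * F₁) oneTree≡ ⟨
      T₁ * F₂ + T̄₂ * F₁
    ∎)
  cross : ∀ k → onOneTwo k T₁ T̄₁ * F₂ ≡ onOneTwo k T₂ T̄₂ * F₁
  cross zero = refl
  cross (suc zero) = oneTree≡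
  cross (suc (suc zero)) = twoTrees≡
  cross (suc (suc (suc k))) = refl

P-GS-equal : ∀ a₁ b₁ c₁ a₂ b₂ c₂ → 1 ≤ b₁ → 1 ≤ b₂ →
  oneTreeNum a₁ b₁ c₁ * oneTreeDen a₂ b₂ c₂ ≡ oneTreeNum a₂ b₂ c₂ * oneTreeDen a₁ b₁ c₁ →
  ∀ k → P (GS a₁ b₁ c₁) k ≡ P (GS a₂ b₂ c₂) k
P-GS-equal a₁ b₁@(suc _) c₁ a₂ b₂@(suc _) c₂ 1≤b₁ 1≤b₂ fractions =
  P-from-oneTree (GS a₁ b₁ c₁) (GS a₂ b₂ c₂) T₁ (twoTrees a₁ b₁ c₁) T₂ (twoTrees a₂ b₂ c₂)
    (countOrderings-GS a₁ b₁ c₁) (oneTree+twoTrees a₁ b₁ c₁)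
    (countOrderings-GS a₂ b₂ c₂) (oneTree+twoTrees a₂ b₂ c₂)
    (*-cancelʳ-≡ (T₁ * F₂) (T₂ * F₁) (Q₁ * Q₂) (begin
        T₁ * F₂ * (Q₁ * Q₂)
      ≡⟨ regroup₁ T₁ F₂ Q₁ Q₂ ⟩
        (T₁ * Q₁) * (F₂ * Q₂)
      ≡⟨ cong (_* (F₂ * Q₂)) (oneTree-GS a₁ b₁ c₁ 1≤b₁) ⟩
        (F₁ * X₁) * (F₂ * Q₂)
      ≡⟨ regroup₂ F₁ X₁ F₂ Q₂ ⟩
        F₁ * F₂ * (X₁ * Q₂)
      ≡⟨ cong (F₁ * F₂ *_) fractions ⟩
        F₁ * F₂ * (X₂ * Q₁)
      ≡⟨ regroup₃ F₁ F₂ X₂ Q₁ ⟨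
        (F₂ * X₂) * (F₁ * Q₁)
      ≡⟨ cong (_* (F₁ * Q₁)) (oneTree-GS a₂ b₂ c₂ 1≤b₂) ⟨
        (T₂ * Q₂) * (F₁ * Q₁)
      ≡⟨ regroup₁ T₂ F₁ Q₂ Q₁ ⟨
        T₂ * F₁ * (Q₂ * Q₁)
      ≡⟨ cong (T₂ * F₁ *_) (*-comm Q₂ Q₁) ⟩
        T₂ * F₁ * (Q₁ * Q₂)
      ∎))
  where
  open ≡-Reasoning
  T₁ = oneTree a₁ b₁ c₁
  T₂ = oneTree a₂ b₂ c₂
  F₁ = length (edges (GS a₁ b₁ c₁)) !
  F₂ = length (edges (GS a₂ b₂ c₂)) !
  X₁ = oneTreeNum a₁ b₁ c₁
  X₂ = oneTreeNum a₂ b₂ c₂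
  Q₁ = oneTreeDen a₁ b₁ c₁
  Q₂ = oneTreeDen a₂ b₂ c₂
  regroup₁ : ∀ T F Q Q' → T * F * (Q * Q') ≡ (T * Q) * (F * Q')
  regroup₁ = solve-∀
  regroup₂ : ∀ F X F' Q' → (F * X) * (F' * Q') ≡ F * F' * (X * Q')
  regroup₂ = solve-∀
  regroup₃ : ∀ F F' X Q → (F' * X) * (F * Q) ≡ F * F' * (X * Q)
  regroup₃ = solve-∀

-- If  x·y = 2t(t+1)  then, with
-- N = x + y + 3t + 1,  x·N = (x+2t)(x+t+1)  and  x·(x+2y+4t+2) = (x+2t)(x+2t+2),
-- whence  x·N(N+1) = (x+2y+4t+2)·(x+t)(x+t+1)  after multiplying by x.
module _ (x y t : ℕ) (xy : x * y ≡ 2 * t * (t + 1)) where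

  private
    via-xy : ∀ lhs p rhs → lhs ≡ x * y + p → 2 * t * (t + 1) + p ≡ rhs → lhs ≡ rhs
    via-xy lhs p rhs e₁ e₂ = trans e₁ (trans (cong (_+ p) xy) e₂)

  x·N : x * (x + y + 3 * t + 1) ≡ (x + 2 * t) * (x + t + 1)
  x·N = via-xy _ (x * (x + 3 * t + 1)) _ (expand x y t) (factor x t)
    where
    expand : ∀ x y t → x * (x + y + 3 * t + 1) ≡ x * y + x * (x + 3 * t + 1)
    expand = solve-∀
    factor : ∀ x t → 2 * t * (t + 1) + x * (x + 3 * t + 1) ≡ (x + 2 * t) * (x + t + 1)
    factor = solve-∀

  x·K : x * (x + 2 * y + 4 * t + 2) ≡ (x + 2 * t) * (x + 2 * t + 2)
  x·K = via-xy _ (x * y + x * (x + 4 * t + 2)) _ (expand x y t) (trans (cong (2 * t * (t + 1) +_) (cong (_+ x * (x + 4 * t + 2)) xy)) (factor x t))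
    where
    expand : ∀ x y t → x * (x + 2 * y + 4 * t + 2) ≡ x * y + (x * y + x * (x + 4 * t + 2))
    expand = solve-∀
    factor : ∀ x t → 2 * t * (t + 1) + (2 * t * (t + 1) + x * (x + 4 * t + 2)) ≡ (x + 2 * t) * (x + 2 * t + 2)
    factor = solve-∀

  key : 1 ≤ x → x * ((x + y + 3 * t + 1) * suc (x + y + 3 * t + 1)) ≡ (x + 2 * y + 4 * t + 2) * ((x + t) * suc (x + t))
  key 1≤x = *-cancelˡ-≡ _ _ x {{>-nonZero 1≤x}} (begin
      x * (x * (N * suc N))
    ≡⟨ square-out x N ⟩
      (x * N) * (x * N + x)
    ≡⟨ cong (λ z → z * (z + x)) x·N ⟩
      ((x + 2 * t) * (x + t + 1)) * ((x + 2 * t) * (x + t + 1) + x)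
    ≡⟨ factor x t ⟩
      ((x + 2 * t) * (x + 2 * t + 2)) * ((x + t) * suc (x + t))
    ≡⟨ cong (_* ((x + t) * suc (x + t))) x·K ⟨
      (x * (x + 2 * y + 4 * t + 2)) * ((x + t) * suc (x + t))
    ≡⟨ *-assoc x _ _ ⟩
      x * ((x + 2 * y + 4 * t + 2) * ((x + t) * suc (x + t)))
    ∎)
    where
    open ≡-Reasoning
    N = x + y + 3 * t + 1
    square-out : ∀ x N → x * (x * (N * suc N)) ≡ (x * N) * (x * N + x)
    square-out = solve-∀
    factor : ∀ x t → ((x + 2 * t) * (x + t + 1)) * ((x + 2 * t) * (x + t + 1) + x) ≡ ((x + 2 * t) * (x + 2 * t + 2)) * ((x + t) * suc (x + t))
    factor = solve-∀

  fractions-agree : 1 ≤ x →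
    oneTreeNum (y + 3 * t + 1) x t * oneTreeDen t (x + y + 2 * t + 1) t
      ≡ oneTreeNum t (x + y + 2 * t + 1) t * oneTreeDen (y + 3 * t + 1) x t
  fractions-agree 1≤x = begin
      x * (E + (x + (y + 3 * t + 1)) * suc (x + (y + 3 * t + 1))) * (D′ * D′)
    ≡⟨ expand x y t ⟩
      (x * E + x * D) * (D * D)
    ≡⟨ cong (λ z → (x * E + z) * (D * D)) (key 1≤x) ⟩
      (x * E + (x + 2 * y + 4 * t + 2) * E) * (D * D)
    ≡⟨ collect x y t ⟩
      B * (D′ + D′) * (E * ((x + (y + 3 * t + 1)) * suc (x + (y + 3 * t + 1))))
    ∎
    where
    open ≡-Reasoning
    N = x + y + 3 * t + 1
    B = x + y + 2 * t + 1
    D = N * suc N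
    D′ = (B + t) * suc (B + t)
    E = (x + t) * suc (x + t)
    expand : ∀ x y t → let N = x + y + 3 * t + 1; D′ = (x + y + 2 * t + 1 + t) * suc (x + y + 2 * t + 1 + t); E = (x + t) * suc (x + t) in
      x * (E + (x + (y + 3 * t + 1)) * suc (x + (y + 3 * t + 1))) * (D′ * D′) ≡ (x * E + x * (N * suc N)) * ((N * suc N) * (N * suc N))
    expand = solve-∀
    collect : ∀ x y t → let N = x + y + 3 * t + 1; B = x + y + 2 * t + 1; D′ = (B + t) * suc (B + t); E = (x + t) * suc (x + t) in
      (x * E + (x + 2 * y + 4 * t + 2) * E) * ((N * suc N) * (N * suc N))
        ≡ B * (D′ + D′) * (E * ((x + (y + 3 * t + 1)) * suc (x + (y + 3 * t + 1))))
    collect = solve-∀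

GS-equal : ∀ {x y t} → 1 ≤ x → x * y ≡ 2 * t * (t + 1) → ∀ a B → a ≡ y + 3 * t + 1 → B ≡ x + y + 2 * t + 1 →
  ∀ k → P (GS a x t) k ≡ P (GS t B t) k
GS-equal {x} {y} {t} 1≤x xy _ _ refl refl =
  P-GS-equal (y + 3 * t + 1) x t t (x + y + 2 * t + 1) t 1≤x (m≤n+m 1 (x + y + 2 * t)) (fractions-agree x y t xy 1≤x)

factor-positive : ∀ r s t → 1 ≤ t → r * s ≡ 2 * t * (t + 1) → 1 ≤ r
factor-positive zero s (suc t) _ ()
factor-positive (suc r) s t _ _ = s≤s z≤n

proposition4 : (s t r : ℕ) → 1 ≤ s → 1 ≤ t → s ∣ 2 * t * (t + 1) →
    r * s ≡ 2 * t * (t + 1) → (k : ℕ) →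
    (P (GS (r + 3 * t + 1) s t) k ≡ P (GS t (r + s + 2 * t + 1) t) k)
    × (P (GS t (r + s + 2 * t + 1) t) k ≡ P (GS (3 * t + s + 1) r t) k)
proposition4 s t r 1≤s 1≤t _ rs k =
  GS-equal 1≤s (trans (*-comm s r) rs) _ _ refl (swap-r-s r s t) k ,
  sym (GS-equal (factor-positive r s t 1≤t rs) rs _ _ (move-s s t) refl k)
  where
  swap-r-s : ∀ r s t → r + s + 2 * t + 1 ≡ s + r + 2 * t + 1
  swap-r-s = solve-∀
  move-s : ∀ s t → 3 * t + s + 1 ≡ s + 3 * t + 1
  move-s = solve-∀
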